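{- Let $\mathcal{C}$ and $\mathcal{D}$ be flCwFs and let $F$ be a weak flCwF morphism from $\mathcal{C}$ to $\mathcal{D}$. Then $F$ preserves the fl-structure up to type isomorphism: for every context $\Gamma$ of $\mathcal{C}$, all types $A : \mathsf{Ty}_{\mathcal{C}}\,\Gamma$, $B : \mathsf{Ty}_{\mathcal{C}}\,(\Gamma\triangleright A)$, every context $\Delta$ of $\mathcal{C}$ and all terms $t,u : \mathsf{Tm}_{\mathcal{C}}\,\Gamma\,A$, there are type isomorphisms in the type category of $F\Gamma$ in $\mathcal{D}$: \[ F_{\Sigma} : F(\Sigma\,A\,B) \simeq \Sigma\,(FA)\,((FB)[F_{\triangleright}^{ -1}]),\qquad F_{\mathsf{K}} : F(\mathsf{K}\,\Delta)\simeq \mathsf{K}\,(F\Delta),\qquad F_{\mathsf{Id}} : F(\mathsf{Id}\,A\,t\,u)\simeq \mathsf{Id}\,(FA)\,(Ft)\,(Fu). \] These isomorphisms are natural with respect to substitution: for a substitution $\sigma$ of $\mathcal{C}$, reindexing (via the functorial action of $F\sigma$ on type categories) the isomorphism $F_\Sigma$ (resp. $F_{\mathsf{K}}$, $F_{\mathsf{Id}}$) for given data yields the isomorphism $F_\Sigma$ (resp. $F_{\mathsf{K}}$, $F_{\mathsf{Id}}$) for the correspondingly substituted data. Moreover, $F$ preserves all term and substitution formers of the fl-structure (modulo these isomorphisms); for example, for $t : \mathsf{Tm}_{\mathcal{C}}\,\Gamma\,(\Sigma\,A\,B)$ one has $F(\mathsf{proj}_1\,t) = \mathsf{proj}_1\,(F_{\Sigma}[\mathsf{id},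 Ft])$.
   Context: The metatheory is extensional type theory (equality reflection, uniqueness of identity proofs) with a hierarchy of universes $\mathsf{Set}_i$. A category with families (CwF) consists of a category of contexts $\mathsf{Con}$ and substitutions $\mathsf{Sub}\,\Gamma\,\Delta$ (identity $\mathsf{id}$, composition $\circ$), types $\mathsf{Ty}\,\Gamma$ and terms $\mathsf{Tm}\,\Gamma\,A$ with substitution operations $A[\sigma]$, $t[\sigma]$ (functorial), a terminal empty context $\bullet$ with unique maps $\epsilon$, and context extension $\Gamma\triangleright A$ with $\mathsf{p} : \mathsf{Sub}\,(\Gamma\triangleright A)\,\Gamma$, $\mathsf{q} : \mathsf{Tm}\,(\Gamma\triangleright A)\,(A[\mathsf{p}])$ and pairing $(\sigma, t) : \mathsf{Sub}\,\Gamma\,(\Delta\triangleright A)$ for $t : \mathsf{Tm}\,\Gamma\,(A[\sigma])$, satisfying the usual $\beta\eta$ laws. An flCwF is a CwF equipped with: $\Sigma$-types $\Sigma\,A\,B : \mathsf{Ty}\,\Gamma$ for $A:\mathsf{Ty}\,\Gamma$, $B : \mathsf{Ty}\,(\Gamma\triangleright A)$, with pairing and projections $\mathsf{proj}_1,\mathsf{proj}_2$ (with $\beta\eta$, stable under substitution); extensional identity types $\mathsf{Id}\,A\,t\,u : \mathsf{Ty}\,\Gamma$ with $\mathsf{refl}$, equality reflection and UIP; and constant families: for every context $\Delta$ and every $\Gamma$, a type $\mathsf{K}\,\Delta : \mathsf{Ty}\,\Gamma$ stable under substitution, with a natural bijection $\mathsf{lam}^{\mathsf{K}} : \mathsf{Sub}\,\Gamma\,\Delta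 \to \mathsf{Tm}\,\Gamma\,(\mathsf{K}\,\Delta)$ with inverse $\mathsf{app}^{\mathsf{K}}$. This extra structure ($\Sigma$, $\mathsf{Id}$, $\mathsf{K}$) is called the fl-structure. Type categories: for a context $\Gamma$, the type category has objects $A : \mathsf{Ty}\,\Gamma$ and morphisms from $A$ to $B$ the terms $t : \mathsf{Tm}\,(\Gamma\triangleright A)\,(B[\mathsf{p}])$, identity $\mathsf{q}$, composition $t\circ u := t[\mathsf{p}, u]$. For $\sigma : \mathsf{Sub}\,\Gamma\,\Delta$ there is a reindexing functor from the type category of $\Delta$ to that of $\Gamma$: $A\mapsto A[\sigma]$, $t\mapsto t[\sigma\circ\mathsf{p},\mathsf{q}]$. A type isomorphism $A\simeq B$ is an isomorphism in a type category; a context isomorphism is an invertible substitution. A weak flCwF morphism $F$ from $\mathcal{C}$ to $\mathcal{D}$ is a functor between the underlying categories of contexts together with maps $F : \mathsf{Ty}_{\mathcal{C}}\,\Gamma\to\mathsf{Ty}_{\mathcal{D}}\,(F\Gamma)$ and $F : \mathsf{Tm}_{\mathcal{C}}\,\Gamma\,A\to\mathsf{Tm}_{\mathcal{D}}\,(F\Gamma)\,(FA)$ such that $F(A[\sigma]) = (FA)[F\sigma]$, $F(t[\sigma]) = (Ft)[F\sigma]$, the unique map $\epsilon : \mathsf{Sub}\,(F\bullet)\,\bullet$ has a retraction, and each $(F\mathsf{p}, F\mathsf{q}) : \mathsf{Sub}\,(F(\Gamma\triangleright A))\,(F\Gamma\triangleright FA)$ has an inverse. These isomorphisms are denoted $F_\bullet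 : F\bullet\simeq\bullet$ and $F_{\triangleright} : F(\Gamma\triangleright A)\simeq F\Gamma\triangleright FA$, with inverse $F_{\triangleright}^{ -1}$. -}

module Defs where

open import Level using (Level; _⊔_) renaming (suc to lsuc)
open import Relation.Binary.PropositionalEquality
  using (_≡_; refl; sym; trans; cong; subst)
open import Relation.Binary.HeterogeneousEquality using (_≅_)

-- The metatheory of the paper is extensional; we use Agda's propositional
-- equality with K (UIP holds), transporting along type equations with
-- 'subst', and heterogeneous equality '_≅_' where the two sides live in
-- types that are only propositionally equal.

record CwF (i j k l : Level) : Set (lsuc (i ⊔ j ⊔ k ⊔ l)) where
  infixl 5 _▷_
  infixl 9 _∘_
  infixl 8 _[_]T _[_]t
  infixl 4 _,s_
  field
    Con : Set i
    Sub : Con → Con → Set j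
    id  : ∀ {Γ} → Sub Γ Γ
    _∘_ : ∀ {Γ Δ Θ} → Sub Δ Θ → Sub Γ Δ → Sub Γ Θ
    ass : ∀ {Γ Δ Θ Ξ} {σ : Sub Θ Ξ} {δ : Sub Δ Θ} {ν : Sub Γ Δ} →
          (σ ∘ δ) ∘ ν ≡ σ ∘ (δ ∘ ν)
    idl : ∀ {Γ Δ} {σ : Sub Γ Δ} → id ∘ σ ≡ σ
    idr : ∀ {Γ Δ} {σ : Sub Γ Δ} → σ ∘ id ≡ σ

    Ty    : Con → Set k
    _[_]T : ∀ {Γ Δ} → Ty Δ → Sub Γ Δ → Ty Γ
    [id]T : ∀ {Γ} {A : Ty Γ} → A [ id ]T ≡ A
    [∘]T  : ∀ {Γ Δ Θ} {A : Ty Θ} {σ : Sub Δ Θ} {δ : Sub Γ Δ} →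
            A [ σ ∘ δ ]T ≡ A [ σ ]T [ δ ]T

    Tm    : (Γ : Con) → Ty Γ → Set l
    _[_]t : ∀ {Γ Δ} {A : Ty Δ} → Tm Δ A → (σ : Sub Γ Δ) → Tm Γ (A [ σ ]T)
    [id]t : ∀ {Γ} {A : Ty Γ} {t : Tm Γ A} →
            subst (Tm Γ) [id]T (t [ id ]t) ≡ t
    [∘]t  : ∀ {Γ Δ Θ} {A : Ty Θ} {t : Tm Θ A} {σ : Sub Δ Θ} {δ : Sub Γ Δ} →
            subst (Tm Γ) [∘]T (t [ σ ∘ δ ]t) ≡ t [ σ ]t [ δ ]t

    ∙   : Con
    ε   : ∀ {Γ} → Sub Γ ∙
    ∙η  : ∀ {Γ} (σ : Sub Γ ∙) → σ ≡ ε

    _▷_  : (Γ : Con) → Ty Γ → Con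
    p    : ∀ {Γ} {A : Ty Γ} → Sub (Γ ▷ A) Γ
    q    : ∀ {Γ} {A : Ty Γ} → Tm (Γ ▷ A) (A [ p ]T)
    _,s_ : ∀ {Γ Δ} {A : Ty Δ} (σ : Sub Γ Δ) → Tm Γ (A [ σ ]T) → Sub Γ (Δ ▷ A)
    ▷β₁  : ∀ {Γ Δ} {A : Ty Δ} {σ : Sub Γ Δ} {t : Tm Γ (A [ σ ]T)} →
           p ∘ (σ ,s t) ≡ σ
    ▷β₂  : ∀ {Γ Δ} {A : Ty Δ} {σ : Sub Γ Δ} {t : Tm Γ (A [ σ ]T)} →
           subst (Tm Γ) (trans (sym [∘]T) (cong (A [_]T) ▷β₁)) (q [ σ ,s t ]t) ≡ t
    ▷η   : ∀ {Γ Δ} {A : Ty Δ} {σ : Sub Γ (Δ ▷ A)} →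
           (p ∘ σ ,s subst (Tm Γ) (sym [∘]T) (q [ σ ]t)) ≡ σ

  _↑_ : ∀ {Γ Δ} (σ : Sub Γ Δ) (A : Ty Δ) → Sub (Γ ▷ A [ σ ]T) (Δ ▷ A)
  σ ↑ A = (σ ∘ p ,s subst (Tm _) (sym [∘]T) q)

  ⟨_⟩ : ∀ {Γ} {A : Ty Γ} → Tm Γ A → Sub Γ (Γ ▷ A)
  ⟨ a ⟩ = (id ,s subst (Tm _) (sym [id]T) a)

  -- morphisms from A to B in the type category of Γ
  TyHom : (Γ : Con) → Ty Γ → Ty Γ → Set l
  TyHom Γ A B = Tm (Γ ▷ A) (B [ p ]T)

  tyId : ∀ {Γ} {A : Ty Γ} → TyHom Γ A A
  tyId = q

  tyComp : ∀ {Γ} {A B C : Ty Γ} → TyHom Γ B C → TyHom Γ A B → TyHom Γ A C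
  tyComp {Γ} {A} {B} {C} t u =
    subst (Tm (Γ ▷ A)) (trans (sym [∘]T) (cong (C [_]T) ▷β₁)) (t [ p ,s u ]t)

  record TyIso (Γ : Con) (A B : Ty Γ) : Set l where
    field
      to   : TyHom Γ A B
      from : TyHom Γ B A
      from-to : tyComp from to ≡ tyId
      to-from : tyComp to from ≡ tyId

  reindex : ∀ {Γ Δ} (σ : Sub Γ Δ) {A B : Ty Δ} →
            TyHom Δ A B → TyHom Γ (A [ σ ]T) (B [ σ ]T)
  reindex {Γ} σ {A} {B} t =
    subst (Tm (Γ ▷ A [ σ ]T))
          (trans (sym [∘]T) (trans (cong (B [_]T) ▷β₁) [∘]T))
          (t [ σ ↑ A ]t)

  apHom : ∀ {Γ} {A B : Ty Γ} → TyHom Γ A B → Tm Γ A → Tm Γ B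
  apHom {Γ} {A} {B} t a =
    subst (Tm Γ) (trans (sym [∘]T) (trans (cong (B [_]T) ▷β₁) [id]T)) (t [ ⟨ a ⟩ ]t)

record FlStr {i j k l} (C : CwF i j k l) : Set (i ⊔ j ⊔ k ⊔ l) where
  open CwF C
  field
    Σ'    : ∀ {Γ} (A : Ty Γ) → Ty (Γ ▷ A) → Ty Γ
    Σ[]   : ∀ {Γ Δ} {A : Ty Δ} {B : Ty (Δ ▷ A)} {σ : Sub Γ Δ} →
            Σ' A B [ σ ]T ≡ Σ' (A [ σ ]T) (B [ σ ↑ A ]T)
    pairΣ : ∀ {Γ} {A : Ty Γ} {B : Ty (Γ ▷ A)} (a : Tm Γ A) →
            Tm Γ (B [ ⟨ a ⟩ ]T) → Tm Γ (Σ' A B)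
    proj₁ : ∀ {Γ} {A : Ty Γ} {B : Ty (Γ ▷ A)} → Tm Γ (Σ' A B) → Tm Γ A
    proj₂ : ∀ {Γ} {A : Ty Γ} {B : Ty (Γ ▷ A)} (t : Tm Γ (Σ' A B)) →
            Tm Γ (B [ ⟨ proj₁ t ⟩ ]T)
    Σβ₁   : ∀ {Γ} {A : Ty Γ} {B : Ty (Γ ▷ A)} {a : Tm Γ A}
            {b : Tm Γ (B [ ⟨ a ⟩ ]T)} → proj₁ (pairΣ {B = B} a b) ≡ a
    Σβ₂   : ∀ {Γ} {A : Ty Γ} {B : Ty (Γ ▷ A)} {a : Tm Γ A}
            {b : Tm Γ (B [ ⟨ a ⟩ ]T)} →
            subst (λ x → Tm Γ (B [ ⟨ x ⟩ ]T)) Σβ₁ (proj₂ (pairΣ {B = B} a b)) ≡ b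
    Ση    : ∀ {Γ} {A : Ty Γ} {B : Ty (Γ ▷ A)} {t : Tm Γ (Σ' A B)} →
            pairΣ (proj₁ t) (proj₂ t) ≡ t
    -- stability of the projections under substitution (stability of
    -- pairing follows from these and η)
    proj₁[] : ∀ {Γ Δ} {A : Ty Δ} {B : Ty (Δ ▷ A)} {t : Tm Δ (Σ' A B)}
              {σ : Sub Γ Δ} →
              proj₁ t [ σ ]t ≡ proj₁ (subst (Tm Γ) Σ[] (t [ σ ]t))
    proj₂[] : ∀ {Γ Δ} {A : Ty Δ} {B : Ty (Δ ▷ A)} {t : Tm Δ (Σ' A B)}
              {σ : Sub Γ Δ} →
              proj₂ t [ σ ]t ≅ proj₂ (subst (Tm Γ) Σ[] (t [ σ ]t))

    Id      : ∀ {Γ} (A : Ty Γ) → Tm Γ A → Tm Γ A → Ty Γ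
    Id[]    : ∀ {Γ Δ} {A : Ty Δ} {t u : Tm Δ A} {σ : Sub Γ Δ} →
              Id A t u [ σ ]T ≡ Id (A [ σ ]T) (t [ σ ]t) (u [ σ ]t)
    reflId  : ∀ {Γ} {A : Ty Γ} {t : Tm Γ A} → Tm Γ (Id A t t)
    reflect : ∀ {Γ} {A : Ty Γ} {t u : Tm Γ A} → Tm Γ (Id A t u) → t ≡ u
    UIP     : ∀ {Γ} {A : Ty Γ} {t u : Tm Γ A} (e e' : Tm Γ (Id A t u)) → e ≡ e'

    K     : ∀ {Γ} (Δ : Con) → Ty Γ
    K[]   : ∀ {Γ Θ Δ} {σ : Sub Γ Θ} → K {Θ} Δ [ σ ]T ≡ K Δ
    lamK  : ∀ {Γ Δ} → Sub Γ Δ → Tm Γ (K Δ)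
    appK  : ∀ {Γ Δ} → Tm Γ (K Δ) → Sub Γ Δ
    Kβ    : ∀ {Γ Δ} {σ : Sub Γ Δ} → appK (lamK σ) ≡ σ
    Kη    : ∀ {Γ Δ} {t : Tm Γ (K Δ)} → lamK (appK t) ≡ t
    lamK[] : ∀ {Γ Θ Δ} {σ : Sub Θ Δ} {δ : Sub Γ Θ} →
             lamK (σ ∘ δ) ≡ subst (Tm Γ) K[] (lamK σ [ δ ]t)

record FlCwF (i j k l : Level) : Set (lsuc (i ⊔ j ⊔ k ⊔ l)) where
  field
    cwf : CwF i j k l
    fl  : FlStr cwf
  open CwF cwf public
  open FlStr fl public

record WeakMor {i j k l i' j' k' l'} (C : CwF i j k l) (D : CwF i' j' k' l')
       : Set (i ⊔ j ⊔ k ⊔ l ⊔ i' ⊔ j' ⊔ k' ⊔ l') where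
  private
    module C = CwF C
    module D = CwF D
  field
    FCon : C.Con → D.Con
    FSub : ∀ {Γ Δ} → C.Sub Γ Δ → D.Sub (FCon Γ) (FCon Δ)
    F-id : ∀ {Γ} → FSub (C.id {Γ}) ≡ D.id
    F-∘  : ∀ {Γ Δ Θ} {σ : C.Sub Δ Θ} {δ : C.Sub Γ Δ} →
           FSub (σ C.∘ δ) ≡ FSub σ D.∘ FSub δ
    FTy  : ∀ {Γ} → C.Ty Γ → D.Ty (FCon Γ)
    FTm  : ∀ {Γ} {A : C.Ty Γ} → C.Tm Γ A → D.Tm (FCon Γ) (FTy A)
    FTy[] : ∀ {Γ Δ} {A : C.Ty Δ} {σ : C.Sub Γ Δ} →
            FTy (A C.[ σ ]T) ≡ FTy A D.[ FSub σ ]T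
    FTm[] : ∀ {Γ Δ} {A : C.Ty Δ} {t : C.Tm Δ A} {σ : C.Sub Γ Δ} →
            subst (D.Tm (FCon Γ)) FTy[] (FTm (t C.[ σ ]t)) ≡ FTm t D.[ FSub σ ]t
    F∙⁻¹   : D.Sub D.∙ (FCon C.∙)
    F∙-ret : F∙⁻¹ D.∘ D.ε ≡ D.id
    F▷⁻¹   : ∀ {Γ} {A : C.Ty Γ} → D.Sub (FCon Γ D.▷ FTy A) (FCon (Γ C.▷ A))
    F▷-inv₁ : ∀ {Γ} {A : C.Ty Γ} →
              F▷⁻¹ D.∘ (FSub C.p D.,s subst (D.Tm _) FTy[] (FTm (C.q {A = A}))) ≡ D.id
    F▷-inv₂ : ∀ {Γ} {A : C.Ty Γ} →
              (FSub C.p D.,s subst (D.Tm _) FTy[] (FTm (C.q {A = A}))) D.∘ F▷⁻¹ ≡ D.id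

record PreservesFl {i j k l i' j' k' l'} (C : FlCwF i j k l) (D : FlCwF i' j' k' l')
       (F : WeakMor (FlCwF.cwf C) (FlCwF.cwf D))
       : Set (i ⊔ j ⊔ k ⊔ l ⊔ i' ⊔ j' ⊔ k' ⊔ l') where
  private
    module C = FlCwF C
    module D = FlCwF D
  open WeakMor F
  open D using (TyIso)
  open TyIso
  field
    FΣ  : ∀ {Γ} (A : C.Ty Γ) (B : C.Ty (Γ C.▷ A)) →
          TyIso (FCon Γ) (FTy (C.Σ' A B)) (D.Σ' (FTy A) (FTy B D.[ F▷⁻¹ ]T))
    FK  : ∀ {Γ} (Δ : C.Con) →
          TyIso (FCon Γ) (FTy (C.K {Γ} Δ)) (D.K (FCon Δ))
    FId : ∀ {Γ} (A : C.Ty Γ) (t u : C.Tm Γ A) →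
          TyIso (FCon Γ) (FTy (C.Id A t u)) (D.Id (FTy A) (FTm t) (FTm u))

    FΣ-nat  : ∀ {Γ Δ} (σ : C.Sub Γ Δ) (A : C.Ty Δ) (B : C.Ty (Δ C.▷ A)) →
              D.reindex (FSub σ) (to (FΣ A B)) ≅ to (FΣ (A C.[ σ ]T) (B C.[ σ C.↑ A ]T))
    FK-nat  : ∀ {Γ Θ} (σ : C.Sub Γ Θ) (Δ : C.Con) →
              D.reindex (FSub σ) (to (FK {Θ} Δ)) ≅ to (FK {Γ} Δ)
    FId-nat : ∀ {Γ Δ} (σ : C.Sub Γ Δ) (A : C.Ty Δ) (t u : C.Tm Δ A) →
              D.reindex (FSub σ) (to (FId A t u))
                ≅ to (FId (A C.[ σ ]T) (t C.[ σ ]t) (u C.[ σ ]t))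

    F-proj₁ : ∀ {Γ} {A : C.Ty Γ} {B : C.Ty (Γ C.▷ A)} (t : C.Tm Γ (C.Σ' A B)) →
              FTm (C.proj₁ t) ≡ D.proj₁ (D.apHom (to (FΣ A B)) (FTm t))
    F-proj₂ : ∀ {Γ} {A : C.Ty Γ} {B : C.Ty (Γ C.▷ A)} (t : C.Tm Γ (C.Σ' A B)) →
              FTm (C.proj₂ t) ≅ D.proj₂ (D.apHom (to (FΣ A B)) (FTm t))
    F-pair  : ∀ {Γ} {A : C.Ty Γ} {B : C.Ty (Γ C.▷ A)} (a : C.Tm Γ A)
              (b : C.Tm Γ (B C.[ C.⟨ a ⟩ ]T))
              (b' : D.Tm (FCon Γ) ((FTy B D.[ F▷⁻¹ ]T) D.[ D.⟨ FTm a ⟩ ]T)) →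
              b' ≅ FTm b →
              FTm (C.pairΣ {B = B} a b) ≡ D.apHom (from (FΣ A B)) (D.pairΣ (FTm a) b')
    F-refl  : ∀ {Γ} {A : C.Ty Γ} {t : C.Tm Γ A} →
              FTm (C.reflId {t = t}) ≡ D.apHom (from (FId A t t)) D.reflId
    F-lamK  : ∀ {Γ Δ} (σ : C.Sub Γ Δ) →
              FTm (C.lamK σ) ≡ D.apHom (from (FK Δ)) (D.lamK (FSub σ))
    F-appK  : ∀ {Γ Δ} (t : C.Tm Γ (C.K Δ)) →
              FSub (C.appK t) ≡ D.appK (D.apHom (to (FK Δ)) (FTm t))

module Submission where

-- A weak morphism preserves context extension up to the isomorphism F▷⁻¹, and
-- each fl-former is characterised by a universal property over context
-- extensions, so it is preserved up to isomorphism. For Σ, the forward map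
-- pairs the images under F of the two projections of the generic element of
-- Σ A B, and the backward map is the image under F of the generic pair in
-- context Γ ▷ A ▷ B; both composites are the identity by β and η for Σ in C
-- and in D. For K, the forward map is lamK applied to the image of the
-- generic substitution appK q; the backward map is the image of lamK id, and
-- it is well typed because any two substitutions into F ∙ agree, F ∙ being a
-- retract of ∙. For Id, equality reflection in C turns the generic proof into
-- an equation between Ft and Fu, so refl is the forward map; reflection in D
-- types the image of refl as the backward map, and UIP gives both identities.

open import Level using (Level)
open import Defs
open import Data.Product using (Σ; _,_)
open import Relation.Binary.PropositionalEquality as E using (_≡_; refl; subst; cong)
open import Relation.Binary.HeterogeneousEquality as H using (_≅_; refl; ≅-to-≡; ≡-to-≅)

infixr 5 _⟨≅⟩_
_⟨≅⟩_ : ∀ {a} {A B C : Set a} {x : A} {y : B} {z : C} → x ≅ y → y ≅ z → x ≅ z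
_⟨≅⟩_ = H.trans

infixr 5 _⊙_
_⊙_ : ∀ {a} {A : Set a} {x y z : A} → x ≡ y → y ≡ z → x ≡ z
_⊙_ = E.trans
!_ : ∀ {a} {A : Set a} {x y : A} → x ≡ y → y ≡ x
!_ = E.sym
infix 10 !_

module CwF-Properties {i j k l} (C : CwF i j k l) where
  open CwF C

  -- Equality of terms whose types (for _≋_ also contexts) may differ, stated
  -- as equality of dependent pairs; it avoids transport along type equations.
  infix 4 _≈_ _≋_
  _≈_ : ∀ {Γ} {A A' : Ty Γ} → Tm Γ A → Tm Γ A' → Set _
  _≈_ {Γ} {A} {A'} t t' = _≡_ {A = Σ (Ty Γ) (Tm Γ)} (A , t) (A' , t')
  _≋_ : ∀ {Γ Γ'} {A : Ty Γ} {A' : Ty Γ'} → Tm Γ A → Tm Γ' A' → Set _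
  _≋_ {Γ} {Γ'} {A} {A'} t t' =
    _≡_ {A = Σ Con (λ Γ → Σ (Ty Γ) (Tm Γ))} (Γ , A , t) (Γ' , A' , t')

  ≈→≋ : ∀ {Γ} {A A' : Ty Γ} {t : Tm Γ A} {t' : Tm Γ A'} → t ≈ t' → t ≋ t'
  ≈→≋ refl = refl
  ≈→≡ : ∀ {Γ} {A : Ty Γ} {t t' : Tm Γ A} → t ≈ t' → t ≡ t'
  ≈→≡ refl = refl
  ≋→≈ : ∀ {Γ} {A A' : Ty Γ} {t : Tm Γ A} {t' : Tm Γ A'} → t ≋ t' → t ≈ t'
  ≋→≈ refl = refl
  ≋→≅ : ∀ {Γ Γ'} {A : Ty Γ} {A' : Ty Γ'} {t : Tm Γ A} {t' : Tm Γ' A'} → t ≋ t' → t ≅ t'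
  ≋→≅ refl = refl
  ≡→≈ : ∀ {Γ} {A : Ty Γ} {t t' : Tm Γ A} → t ≡ t' → t ≈ t'
  ≡→≈ refl = refl

  cast : ∀ {Γ} {A A' : Ty Γ} → A ≡ A' → Tm Γ A → Tm Γ A'
  cast e t = subst (Tm _) e t

  cast≈ : ∀ {Γ} {A A' : Ty Γ} (e : A ≡ A') {t : Tm Γ A} → cast e t ≈ t
  cast≈ refl = refl

  []t-cong : ∀ {Γ Δ} {A A' : Ty Δ} {t : Tm Δ A} {t' : Tm Δ A'}
           {σ σ' : Sub Γ Δ} → t ≈ t' → σ ≡ σ' → t [ σ ]t ≈ t' [ σ' ]t
  []t-cong refl refl = refl

  []t-cong≋ : ∀ {Γ Γ' Δ Δ'} {A : Ty Δ} {A' : Ty Δ'} {t : Tm Δ A} {t' : Tm Δ' A'}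
           {σ : Sub Γ Δ} {σ' : Sub Γ' Δ'} → t ≋ t' → Γ ≡ Γ' → σ ≅ σ' → t [ σ ]t ≋ t' [ σ' ]t
  []t-cong≋ refl refl refl = refl

  []T-cong≅ : ∀ {Γ Γ' Δ Δ'} {A : Ty Δ} {A' : Ty Δ'} {σ : Sub Γ Δ} {σ' : Sub Γ' Δ'} →
           Γ ≡ Γ' → Δ ≡ Δ' → A ≅ A' → σ ≅ σ' → A [ σ ]T ≅ A' [ σ' ]T
  []T-cong≅ refl refl refl refl = refl

  ∘-cong≅ : ∀ {Γ Γ' Δ Δ' Θ} {σ : Sub Δ Θ} {σ' : Sub Δ' Θ} {δ : Sub Γ Δ} {δ' : Sub Γ' Δ'} →
           Γ ≡ Γ' → Δ ≡ Δ' → σ ≅ σ' → δ ≅ δ' → σ ∘ δ ≅ σ' ∘ δ'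
  ∘-cong≅ refl refl refl refl = refl

  ▷-cong : ∀ {Γ} {A A' : Ty Γ} → A ≡ A' → (Γ ▷ A) ≡ (Γ ▷ A')
  ▷-cong = cong (_ ▷_)

  p-cong≅ : ∀ {Γ} {A A' : Ty Γ} → A ≡ A' → p {A = A} ≅ p {A = A'}
  p-cong≅ refl = refl

  q-cong≋ : ∀ {Γ} {A A' : Ty Γ} → A ≡ A' → q {A = A} ≋ q {A = A'}
  q-cong≋ refl = refl

  ,s-cong : ∀ {Γ Δ} {A : Ty Δ} {σ σ' : Sub Γ Δ} {t : Tm Γ (A [ σ ]T)} {t' : Tm Γ (A [ σ' ]T)} →
           σ ≡ σ' → t ≈ t' → (σ ,s t) ≡ (σ' ,s t')
  ,s-cong refl refl = refl

  [id]t≈ : ∀ {Γ} {A : Ty Γ} {t : Tm Γ A} → t [ id ]t ≈ t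
  [id]t≈ = ! cast≈ [id]T ⊙ cong (_ ,_) [id]t

  [∘]t≈ : ∀ {Γ Δ Θ} {A : Ty Θ} {t : Tm Θ A} {σ : Sub Δ Θ} {δ : Sub Γ Δ} →
          t [ σ ∘ δ ]t ≈ t [ σ ]t [ δ ]t
  [∘]t≈ = ! cast≈ [∘]T ⊙ cong (_ ,_) [∘]t

  ▷β₂≈ : ∀ {Γ Δ} {A : Ty Δ} {σ : Sub Γ Δ} {t : Tm Γ (A [ σ ]T)} → q [ σ ,s t ]t ≈ t
  ▷β₂≈ = ! cast≈ _ ⊙ cong (_ ,_) ▷β₂

  ▷-ext : ∀ {Γ Δ} {A : Ty Δ} {σ τ : Sub Γ (Δ ▷ A)} →
        p ∘ σ ≡ p ∘ τ → q [ σ ]t ≈ q [ τ ]t → σ ≡ τ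
  ▷-ext e1 e2 = ! ▷η ⊙ ,s-cong e1 (cast≈ _ ⊙ e2 ⊙ ! cast≈ _) ⊙ ▷η

  ▷-ext≅ : ∀ {Γ Δ} {X X' : Ty Γ} {A : Ty Δ} {σ : Sub (Γ ▷ X) (Δ ▷ A)} {τ : Sub (Γ ▷ X') (Δ ▷ A)} →
         X ≡ X' → p ∘ σ ≅ p ∘ τ → q [ σ ]t ≋ q [ τ ]t → σ ≅ τ
  ▷-ext≅ refl e1 e2 = ≡-to-≅ (▷-ext (≅-to-≡ e1) (≋→≈ e2))

  ,∘ : ∀ {Γ Δ Θ} {A : Ty Θ} {σ : Sub Δ Θ} {t : Tm Δ (A [ σ ]T)} {δ : Sub Γ Δ} →
       (σ ,s t) ∘ δ ≡ (σ ∘ δ ,s cast (! [∘]T) (t [ δ ]t))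
  ,∘ = ▷-ext (! ass ⊙ cong (_∘ _) ▷β₁ ⊙ ! ▷β₁)
           ([∘]t≈ ⊙ []t-cong ▷β₂≈ refl ⊙ ! cast≈ _ ⊙ ! ▷β₂≈)

  q[↑] : ∀ {Γ Δ} {σ : Sub Γ Δ} {A : Ty Δ} → q [ σ ↑ A ]t ≈ q {A = A [ σ ]T}
  q[↑] = ▷β₂≈ ⊙ cast≈ _

  q[⟨⟩] : ∀ {Γ} {A : Ty Γ} {a : Tm Γ A} → q [ ⟨ a ⟩ ]t ≈ a
  q[⟨⟩] = ▷β₂≈ ⊙ cast≈ _

  ↑⟨⟩ : ∀ {Γ Δ} {σ : Sub Γ Δ} {A : Ty Δ} {a : Tm Γ (A [ σ ]T)} → (σ ↑ A) ∘ ⟨ a ⟩ ≡ (σ ,s a)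
  ↑⟨⟩ = ▷-ext (! ass ⊙ cong (_∘ _) ▷β₁ ⊙ ass ⊙ cong (_ ∘_) ▷β₁ ⊙ idr ⊙ ! ▷β₁)
            ([∘]t≈ ⊙ []t-cong q[↑] refl ⊙ q[⟨⟩] ⊙ ! ▷β₂≈)

  ,s-unique : ∀ {Γ Δ} {A : Ty Δ} {σ : Sub Γ (Δ ▷ A)} {τ : Sub Γ Δ} {t : Tm Γ (A [ τ ]T)} →
       p ∘ σ ≡ τ → q [ σ ]t ≈ t → σ ≡ (τ ,s t)
  ,s-unique e1 e2 = ▷-ext (e1 ⊙ ! ▷β₁) (e2 ⊙ ! ▷β₂≈)

  tyComp≈ : ∀ {Γ} {A B C : Ty Γ} {t : TyHom Γ B C} {u : TyHom Γ A B} → tyComp t u ≈ t [ p ,s u ]t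
  tyComp≈ = cast≈ _
  apHom≈ : ∀ {Γ} {A B : Ty Γ} {t : TyHom Γ A B} {a : Tm Γ A} → apHom t a ≈ t [ ⟨ a ⟩ ]t
  apHom≈ = cast≈ _
  reindex≈ : ∀ {Γ Δ} {σ : Sub Γ Δ} {A B : Ty Δ} {t : TyHom Δ A B} → reindex σ t ≈ t [ σ ↑ A ]t
  reindex≈ = cast≈ _

  tyComp≡tyId : ∀ {Γ} {A B : Ty Γ} {t : TyHom Γ B A} {u : TyHom Γ A B} →
             t [ p ,s u ]t ≈ q {A = A} → tyComp t u ≡ tyId
  tyComp≡tyId e = ≈→≡ (tyComp≈ ⊙ e)

  ⟨⟩∘ : ∀ {Γ Δ} {A : Ty Δ} {x : Tm Δ A} {σ : Sub Γ Δ} → ⟨ x ⟩ ∘ σ ≡ (σ ,s x [ σ ]t)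
  ⟨⟩∘ = ,s-unique (! ass ⊙ cong (_∘ _) ▷β₁ ⊙ idl) ([∘]t≈ ⊙ []t-cong q[⟨⟩] refl)

  ≅→≈ : ∀ {Γ} {A A' : Ty Γ} {t : Tm Γ A} {t' : Tm Γ A'} → A ≡ A' → t ≅ t' → t ≈ t'
  ≅→≈ refl refl = refl

  subst≈ : ∀ {a} {X : Set a} {Γ} (T : X → Ty Γ) {x y : X} (e : x ≡ y) {s : Tm Γ (T x)} →
            subst (λ z → Tm Γ (T z)) e s ≈ s
  subst≈ T refl = refl

  p∘↑ : ∀ {Γ Δ} {σ : Sub Γ Δ} {A : Ty Δ} → p ∘ (σ ↑ A) ≡ σ ∘ p
  p∘↑ = ▷β₁

  ↑∘↑ : ∀ {Γ Δ Ξ} {σ : Sub Δ Ξ} {δ : Sub Γ Δ} {A : Ty Ξ} →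
       (σ ↑ A) ∘ (δ ↑ (A [ σ ]T)) ≅ (σ ∘ δ) ↑ A
  ↑∘↑ {σ = σ} {δ} {A} = ▷-ext≅ (! [∘]T)
    (≡-to-≅ (! ass ⊙ cong (_∘ (δ ↑ (A [ σ ]T))) (p∘↑ {σ = σ} {A}) ⊙ ass
              ⊙ cong (σ ∘_) (p∘↑ {σ = δ} {A [ σ ]T}) ⊙ ! ass)
      ⟨≅⟩ ∘-cong≅ (▷-cong (! [∘]T)) refl refl (p-cong≅ (! [∘]T)) ⟨≅⟩ ≡-to-≅ (! ▷β₁))
    (≈→≋ ([∘]t≈ ⊙ []t-cong q[↑] refl ⊙ q[↑]) ⊙ q-cong≋ (! [∘]T) ⊙ ≈→≋ (! q[↑]))

  [↑][↑]T : ∀ {Γ Δ Ξ} {σ : Sub Δ Ξ} {δ : Sub Γ Δ} {A : Ty Ξ} {B : Ty (Ξ ▷ A)} →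
            B [ σ ↑ A ]T [ δ ↑ (A [ σ ]T) ]T ≅ B [ (σ ∘ δ) ↑ A ]T
  [↑][↑]T = ≡-to-≅ (! [∘]T) ⟨≅⟩ []T-cong≅ (▷-cong (! [∘]T)) refl refl ↑∘↑

  id↑ : ∀ {Γ} {A : Ty Γ} → id ↑ A ≅ id {Γ ▷ A}
  id↑ {Γ} {A} = ▷-ext≅ [id]T (≡-to-≅ (▷β₁ ⊙ idl) ⟨≅⟩ p-cong≅ [id]T ⟨≅⟩ ≡-to-≅ (! idr))
                  (≈→≋ q[↑] ⊙ q-cong≋ [id]T ⊙ ≈→≋ (! [id]t≈))

module FlCwF-Properties {i j k l} (C : FlCwF i j k l) where
  open FlCwF C public
  open CwF-Properties cwf public

  Σβ₂≈ : ∀ {Γ} {A : Ty Γ} {B : Ty (Γ ▷ A)} {a : Tm Γ A} {b : Tm Γ (B [ ⟨ a ⟩ ]T)} →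
         proj₂ (pairΣ {B = B} a b) ≈ b
  Σβ₂≈ {B = B} = ! subst≈ (λ x → B [ ⟨ x ⟩ ]T) Σβ₁ ⊙ cong (_ ,_) Σβ₂

  pair≈ : ∀ {Γ} {A : Ty Γ} {B : Ty (Γ ▷ A)} {a a' : Tm Γ A} {b : Tm Γ (B [ ⟨ a ⟩ ]T)}
          {b' : Tm Γ (B [ ⟨ a' ⟩ ]T)} → a ≡ a' → b ≈ b' → pairΣ {B = B} a b ≡ pairΣ a' b'
  pair≈ refl refl = refl

  proj₁≋ : ∀ {Γ Γ'} {A : Ty Γ} {A' : Ty Γ'} {B : Ty (Γ ▷ A)} {B' : Ty (Γ' ▷ A')}
          {t : Tm Γ (Σ' A B)} {t' : Tm Γ' (Σ' A' B')} →
          Γ ≡ Γ' → A ≅ A' → B ≅ B' → t ≋ t' → proj₁ t ≋ proj₁ t'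
  proj₁≋ refl refl refl refl = refl

  proj₂≋ : ∀ {Γ Γ'} {A : Ty Γ} {A' : Ty Γ'} {B : Ty (Γ ▷ A)} {B' : Ty (Γ' ▷ A')}
          {t : Tm Γ (Σ' A B)} {t' : Tm Γ' (Σ' A' B')} →
          Γ ≡ Γ' → A ≅ A' → B ≅ B' → t ≋ t' → proj₂ t ≋ proj₂ t'
  proj₂≋ refl refl refl refl = refl

  proj₂[]≈ : ∀ {Γ Δ} {A : Ty Δ} {B : Ty (Δ ▷ A)} {t : Tm Δ (Σ' A B)} {σ : Sub Γ Δ} →
             proj₂ t [ σ ]t ≈ proj₂ (cast Σ[] (t [ σ ]t))
  proj₂[]≈ {B = B} {t} {σ} = ≅→≈ (! [∘]T ⊙ cong (B [_]T) (⟨⟩∘ ⊙ ,s-cong refl (≡→≈ proj₁[]) ⊙ ! ↑⟨⟩)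
      ⊙ [∘]T) proj₂[]

  appK∘ : ∀ {Γ Θ Δ} {t : Tm Θ (K Δ)} {δ : Sub Γ Θ} → appK t ∘ δ ≡ appK (cast K[] (t [ δ ]t))
  appK∘ {t = t} {δ} = ! Kβ ⊙ cong appK (lamK[] ⊙ cong (λ x → cast K[] (x [ δ ]t)) Kη)

  Id-UIP : ∀ {Γ} {A : Ty Γ} {t u : Tm Γ A} {X : Ty Γ} (e : X ≡ Id A t u) (x y : Tm Γ X) → x ≡ y
  Id-UIP refl x y = UIP x y

  -- Projections and pairing for Σ A B [ ρ ], so that the stability law Σ[]
  -- is applied once here rather than at every use.
  module _ {Γ : Con} {A : Ty Γ} {B : Ty (Γ ▷ A)} where
    π₁ : ∀ {Θ} (ρ : Sub Θ Γ) → Tm Θ (Σ' A B [ ρ ]T) → Tm Θ (A [ ρ ]T)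
    π₁ ρ t = proj₁ (cast Σ[] t)
    π₂ : ∀ {Θ} (ρ : Sub Θ Γ) (t : Tm Θ (Σ' A B [ ρ ]T)) → Tm Θ (B [ ρ ↑ A ]T [ ⟨ π₁ ρ t ⟩ ]T)
    π₂ ρ t = proj₂ (cast Σ[] t)
    pairπ : ∀ {Θ} (ρ : Sub Θ Γ) (a : Tm Θ (A [ ρ ]T)) → Tm Θ (B [ ρ ↑ A ]T [ ⟨ a ⟩ ]T) →
         Tm Θ (Σ' A B [ ρ ]T)
    pairπ ρ a b = cast (! Σ[]) (pairΣ a b)

    π₁-[] : ∀ {Θ Ψ} {ρ : Sub Θ Γ} {δ : Sub Ψ Θ} {t : Tm Θ (Σ' A B [ ρ ]T)}
             {t' : Tm Ψ (Σ' A B [ ρ ∘ δ ]T)} → t [ δ ]t ≈ t' → π₁ ρ t [ δ ]t ≈ π₁ (ρ ∘ δ) t'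
    π₁-[] e = ≡→≈ proj₁[] ⊙ ≋→≈ (proj₁≋ refl (≡-to-≅ (! [∘]T)) [↑][↑]T
                 (≈→≋ (cast≈ _ ⊙ []t-cong (cast≈ _) refl ⊙ e ⊙ ! cast≈ _)))

    π₂-[] : ∀ {Θ Ψ} {ρ : Sub Θ Γ} {δ : Sub Ψ Θ} {t : Tm Θ (Σ' A B [ ρ ]T)}
             {t' : Tm Ψ (Σ' A B [ ρ ∘ δ ]T)} → t [ δ ]t ≈ t' → π₂ ρ t [ δ ]t ≈ π₂ (ρ ∘ δ) t'
    π₂-[] e = proj₂[]≈ ⊙ ≋→≈ (proj₂≋ refl (≡-to-≅ (! [∘]T)) [↑][↑]T
                 (≈→≋ (cast≈ _ ⊙ []t-cong (cast≈ _) refl ⊙ e ⊙ ! cast≈ _)))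

    π₁-β : ∀ {Θ} {ρ : Sub Θ Γ} {a : Tm Θ (A [ ρ ]T)} {b : Tm Θ (B [ ρ ↑ A ]T [ ⟨ a ⟩ ]T)} →
           π₁ ρ (pairπ ρ a b) ≡ a
    π₁-β = cong proj₁ (≈→≡ (cast≈ Σ[] ⊙ cast≈ (! Σ[]))) ⊙ Σβ₁

    π₂-β : ∀ {Θ} {ρ : Sub Θ Γ} {a : Tm Θ (A [ ρ ]T)} {b : Tm Θ (B [ ρ ↑ A ]T [ ⟨ a ⟩ ]T)} →
           π₂ ρ (pairπ ρ a b) ≈ b
    π₂-β = cong (λ x → _ , proj₂ x) (≈→≡ (cast≈ Σ[] ⊙ cast≈ (! Σ[]))) ⊙ Σβ₂≈

    pairπ-η : ∀ {Θ} {ρ : Sub Θ Γ} {t} → pairπ ρ (π₁ ρ t) (π₂ ρ t) ≡ t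
    pairπ-η = ≈→≡ (cast≈ _ ⊙ ≡→≈ Ση ⊙ cast≈ _)

    pairπ-cong : ∀ {Θ} {ρ : Sub Θ Γ} {a a'} {b b'} → a ≡ a' → b ≈ b' → pairπ ρ a b ≡ pairπ ρ a' b'
    pairπ-cong refl refl = refl

    pairπ-unique : ∀ {Θ} {ρ : Sub Θ Γ} {t : Tm Θ (Σ' A B [ ρ ]T)} {a b} →
             π₁ ρ t ≡ a → π₂ ρ t ≈ b → t ≡ pairπ ρ a b
    pairπ-unique e1 e2 = ! pairπ-η ⊙ pairπ-cong e1 e2

    pairπ-[] : ∀ {Θ Ψ} {ρ : Sub Θ Γ} {δ : Sub Ψ Θ}
             {a : Tm Θ (A [ ρ ]T)} {b : Tm Θ (B [ ρ ↑ A ]T [ ⟨ a ⟩ ]T)}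
             {a' : Tm Ψ (A [ ρ ∘ δ ]T)} {b' : Tm Ψ (B [ (ρ ∘ δ) ↑ A ]T [ ⟨ a' ⟩ ]T)} →
             a [ δ ]t ≈ a' → b [ δ ]t ≈ b' → pairπ ρ a b [ δ ]t ≈ pairπ (ρ ∘ δ) a' b'
    pairπ-[] {ρ = ρ} {δ} {a} {b} e1 e2 =
      ! cast≈ (! [∘]T) ⊙ ≡→≈ (pairπ-unique (≈→≡ (! π₁-[] {ρ = ρ} {δ} {t = pairπ ρ a b} (! cast≈ _)
                                             ⊙ []t-cong (≡→≈ (π₁-β {ρ = ρ} {a} {b})) refl ⊙ e1))
                                      (! π₂-[] {ρ = ρ} {δ} {t = pairπ ρ a b} (! cast≈ _)
                                             ⊙ []t-cong (π₂-β {ρ = ρ} {a} {b}) refl ⊙ e2))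

    π₁-[]′ : ∀ {Θ Ψ} {ρ : Sub Θ Γ} {δ : Sub Ψ Θ} {ρ' : Sub Ψ Γ} {t : Tm Θ (Σ' A B [ ρ ]T)}
             {t' : Tm Ψ (Σ' A B [ ρ' ]T)} → ρ ∘ δ ≡ ρ' → t [ δ ]t ≈ t' → π₁ ρ t [ δ ]t ≈ π₁ ρ' t'
    π₁-[]′ refl e = π₁-[] e
    π₂-[]′ : ∀ {Θ Ψ} {ρ : Sub Θ Γ} {δ : Sub Ψ Θ} {ρ' : Sub Ψ Γ} {t : Tm Θ (Σ' A B [ ρ ]T)}
             {t' : Tm Ψ (Σ' A B [ ρ' ]T)} → ρ ∘ δ ≡ ρ' → t [ δ ]t ≈ t' → π₂ ρ t [ δ ]t ≈ π₂ ρ' t'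
    π₂-[]′ refl e = π₂-[] e
    pairπ-[]′ : ∀ {Θ Ψ} {ρ : Sub Θ Γ} {δ : Sub Ψ Θ} {ρ' : Sub Ψ Γ} {a : Tm Θ (A [ ρ ]T)}
             {b : Tm Θ (B [ ρ ↑ A ]T [ ⟨ a ⟩ ]T)}
             {a' : Tm Ψ (A [ ρ' ]T)} {b' : Tm Ψ (B [ ρ' ↑ A ]T [ ⟨ a' ⟩ ]T)} →
             ρ ∘ δ ≡ ρ' → a [ δ ]t ≈ a' → b [ δ ]t ≈ b' → pairπ ρ a b [ δ ]t ≈ pairπ ρ' a' b'
    pairπ-[]′ refl e1 e2 = pairπ-[] e1 e2
    π₁-cong : ∀ {Θ} {ρ ρ' : Sub Θ Γ} {t : Tm Θ (Σ' A B [ ρ ]T)} {t' : Tm Θ (Σ' A B [ ρ' ]T)} →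
           ρ ≡ ρ' → t ≈ t' → π₁ ρ t ≈ π₁ ρ' t'
    π₁-cong refl refl = refl
    π₂-cong : ∀ {Θ} {ρ ρ' : Sub Θ Γ} {t : Tm Θ (Σ' A B [ ρ ]T)} {t' : Tm Θ (Σ' A B [ ρ' ]T)} →
           ρ ≡ ρ' → t ≈ t' → π₂ ρ t ≈ π₂ ρ' t'
    π₂-cong refl refl = refl

    proj₁-π : ∀ {t : Tm Γ (Σ' A B)} {t' : Tm Γ (Σ' A B [ id ]T)} → t ≈ t' → proj₁ t ≈ π₁ id t'
    proj₁-π e = ≋→≈ (proj₁≋ refl (≡-to-≅ (! [id]T)) (≡-to-≅ (! [id]T)
        ⟨≅⟩ []T-cong≅ (▷-cong (! [id]T)) refl refl (H.sym id↑)) (≈→≋ (e ⊙ ! cast≈ _)))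
    proj₂-π : ∀ {t : Tm Γ (Σ' A B)} {t' : Tm Γ (Σ' A B [ id ]T)} → t ≈ t' → proj₂ t ≈ π₂ id t'
    proj₂-π e = ≋→≈ (proj₂≋ refl (≡-to-≅ (! [id]T)) (≡-to-≅ (! [id]T)
        ⟨≅⟩ []T-cong≅ (▷-cong (! [id]T)) refl refl (H.sym id↑)) (≈→≋ (e ⊙ ! cast≈ _)))

  module _ {Γ Θ : Con} {A : Ty Γ} {B : Ty (Γ ▷ A)} {ρ : Sub Θ Γ} where
    π₁-reassoc : ∀ {Ψ} {δ : Sub Ψ Θ} {t : Tm Ψ (Σ' A B [ ρ ∘ δ ]T)}
             {t' : Tm Ψ (Σ' (A [ ρ ]T) (B [ ρ ↑ A ]T) [ δ ]T)} →
            t ≈ t' → π₁ {A = A} {B} (ρ ∘ δ) t ≈ π₁ δ t'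
    π₁-reassoc e = ≋→≈ (proj₁≋ refl (≡-to-≅ [∘]T) (H.sym [↑][↑]T) (≈→≋ (cast≈ _ ⊙ e ⊙ ! cast≈ _)))
    π₂-reassoc : ∀ {Ψ} {δ : Sub Ψ Θ} {t : Tm Ψ (Σ' A B [ ρ ∘ δ ]T)}
             {t' : Tm Ψ (Σ' (A [ ρ ]T) (B [ ρ ↑ A ]T) [ δ ]T)} →
            t ≈ t' → π₂ {A = A} {B} (ρ ∘ δ) t ≈ π₂ δ t'
    π₂-reassoc e = ≋→≈ (proj₂≋ refl (≡-to-≅ [∘]T) (H.sym [↑][↑]T) (≈→≋ (cast≈ _ ⊙ e ⊙ ! cast≈ _)))

  pairπ-unique≋ : ∀ {Γ Θ Θ'} {A A' : Ty Γ} {B : Ty (Γ ▷ A)} {B' : Ty (Γ ▷ A')}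
            {ρ : Sub Θ Γ} {ρ' : Sub Θ' Γ}
            {t : Tm Θ (Σ' A B [ ρ ]T)} {t' : Tm Θ' (Σ' A' B' [ ρ' ]T)} →
            Θ ≡ Θ' → A ≡ A' → B ≅ B' → ρ ≅ ρ' →
            π₁ ρ t ≋ π₁ ρ' t' → π₂ ρ t ≋ π₂ ρ' t' → t ≋ t'
  pairπ-unique≋ refl refl refl refl e1 e2 = ≈→≋ (≡→≈ (pairπ-unique (≈→≡ (≋→≈ e1)) (≋→≈ e2)
      ⊙ pairπ-η))

  π₁-cong≋ : ∀ {Γ Θ Θ'} {A : Ty Γ} {B : Ty (Γ ▷ A)} {ρ : Sub Θ Γ} {ρ' : Sub Θ' Γ}
         {t : Tm Θ (Σ' A B [ ρ ]T)} {t' : Tm Θ' (Σ' A B [ ρ' ]T)} →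
         Θ ≡ Θ' → ρ ≅ ρ' → t ≋ t' → π₁ ρ t ≋ π₁ ρ' t'
  π₁-cong≋ refl refl refl = refl
  π₂-cong≋ : ∀ {Γ Θ Θ'} {A : Ty Γ} {B : Ty (Γ ▷ A)} {ρ : Sub Θ Γ} {ρ' : Sub Θ' Γ}
         {t : Tm Θ (Σ' A B [ ρ ]T)} {t' : Tm Θ' (Σ' A B [ ρ' ]T)} →
         Θ ≡ Θ' → ρ ≅ ρ' → t ≋ t' → π₂ ρ t ≋ π₂ ρ' t'
  π₂-cong≋ refl refl refl = refl

  appK-cong≅ : ∀ {Ψ Ψ' Δ} {x : Tm Ψ (K Δ)} {x' : Tm Ψ' (K Δ)} → Ψ ≡ Ψ' → x ≋ x' → appK x ≅ appK x'
  appK-cong≅ refl refl = refl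
  lamK-cong≋ : ∀ {Ψ Ψ' Δ} {τ : Sub Ψ Δ} {τ' : Sub Ψ' Δ} → Ψ ≡ Ψ' → τ ≅ τ' → lamK τ ≋ lamK τ'
  lamK-cong≋ refl refl = refl
  Id-cong : ∀ {Γ} {A A' : Ty Γ} {t u : Tm Γ A} {t' u' : Tm Γ A'} → t ≈ t' → u ≈ u' →
            Id A t u ≡ Id A' t' u'
  Id-cong refl refl = refl
  Id-UIP≋ : ∀ {Θ Θ'} {T : Ty Θ} {T' : Ty Θ'} {A : Ty Θ'} {t u : Tm Θ' A} →
            Θ ≡ Θ' → T ≅ T' → T' ≡ Id A t u →
        (x : Tm Θ T) (y : Tm Θ' T') → x ≋ y
  Id-UIP≋ refl refl refl x y = cong (λ z → _ , _ , z) (UIP x y)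

module WeakMor-Properties {i j k l i' j' k' l'} (C : FlCwF i j k l) (D : FlCwF i' j' k' l')
          (F : WeakMor (FlCwF.cwf C) (FlCwF.cwf D)) where
  module C = FlCwF-Properties C
  module D = FlCwF-Properties D
  open D
  open WeakMor F

  FTm-cong : ∀ {Γ} {A A' : C.Ty Γ} {t : C.Tm Γ A} {t' : C.Tm Γ A'} → t C.≈ t' → FTm t ≈ FTm t'
  FTm-cong refl = refl
  FTm-cong≋ : ∀ {Γ Γ'} {A : C.Ty Γ} {A' : C.Ty Γ'} {t : C.Tm Γ A} {t' : C.Tm Γ' A'} →
         t C.≋ t' → FTm t ≋ FTm t'
  FTm-cong≋ refl = refl
  FSub-cong≅ : ∀ {Γ Γ' Δ} {σ : C.Sub Γ Δ} {σ' : C.Sub Γ' Δ} → Γ ≡ Γ' → σ ≅ σ' → FSub σ ≅ FSub σ'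
  FSub-cong≅ refl refl = refl

  FTm[]≈ : ∀ {Γ Δ} {A : C.Ty Δ} {t : C.Tm Δ A} {σ : C.Sub Γ Δ} →
           FTm (t C.[ σ ]t) ≈ FTm t [ FSub σ ]t
  FTm[]≈ = ! cast≈ FTy[] ⊙ cong (_ ,_) FTm[]

  F▷ : ∀ {Γ} {A : C.Ty Γ} → Sub (FCon (Γ C.▷ A)) (FCon Γ ▷ FTy A)
  F▷ {A = A} = FSub C.p ,s cast FTy[] (FTm (C.q {A = A}))

  Fp∘F▷⁻¹ : ∀ {Γ} {A : C.Ty Γ} → FSub C.p ∘ F▷⁻¹ {A = A} ≡ p
  Fp∘F▷⁻¹ = cong (_∘ F▷⁻¹) (! ▷β₁) ⊙ ass ⊙ cong (p ∘_) F▷-inv₂ ⊙ idr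

  Fq[F▷⁻¹] : ∀ {Γ} {A : C.Ty Γ} → FTm (C.q {A = A}) [ F▷⁻¹ ]t ≈ q
  Fq[F▷⁻¹] = []t-cong (! cast≈ _ ⊙ ! ▷β₂≈) refl ⊙ ! [∘]t≈ ⊙ []t-cong refl F▷-inv₂ ⊙ [id]t≈

  F▷∘F,s : ∀ {Γ Δ} {A : C.Ty Δ} {σ : C.Sub Γ Δ} {t : C.Tm Γ (A C.[ σ ]T)} →
          F▷ ∘ FSub (σ C.,s t) ≡ (FSub σ ,s cast FTy[] (FTm t))
  F▷∘F,s {σ = σ} {t} = ▷-ext
    (! ass ⊙ cong (_∘ FSub (σ C.,s t)) ▷β₁ ⊙ ! F-∘ ⊙ cong FSub C.▷β₁ ⊙ ! ▷β₁)
    ([∘]t≈ ⊙ []t-cong (▷β₂≈ ⊙ cast≈ _) refl ⊙ ! FTm[]≈ ⊙ FTm-cong C.▷β₂≈ ⊙ ! cast≈ _ ⊙ ! ▷β₂≈)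

  F,s : ∀ {Γ Δ} {A : C.Ty Δ} {σ : C.Sub Γ Δ} {t : C.Tm Γ (A C.[ σ ]T)} →
          FSub (σ C.,s t) ≡ F▷⁻¹ ∘ (FSub σ ,s cast FTy[] (FTm t))
  F,s {σ = σ} {t} = ! idl ⊙ cong (_∘ FSub (σ C.,s t)) (! F▷-inv₁) ⊙ ass ⊙ cong (F▷⁻¹ ∘_) F▷∘F,s

  F⟨⟩ : ∀ {Γ} {A : C.Ty Γ} {t : C.Tm Γ A} → FSub C.⟨ t ⟩ ≡ F▷⁻¹ ∘ ⟨ FTm t ⟩
  F⟨⟩ = F,s ⊙ cong (F▷⁻¹ ∘_) (,s-cong F-id (cast≈ _ ⊙ FTm-cong (C.cast≈ _) ⊙ ! cast≈ _))

  F↑ : ∀ {Γ Δ} {σ : C.Sub Γ Δ} {A : C.Ty Δ} →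
       FSub (σ C.↑ A) ∘ F▷⁻¹ ≅ F▷⁻¹ ∘ (FSub σ ↑ FTy A)
  F↑ {σ = σ} {A} = ≡-to-≅ (cong (_∘ F▷⁻¹) F,s ⊙ ass) ⟨≅⟩ ∘-cong≅ (▷-cong FTy[]) refl refl
    (▷-ext≅ FTy[]
      (≡-to-≅ (! ass ⊙ cong (_∘ F▷⁻¹) (▷β₁ ⊙ F-∘) ⊙ ass ⊙ cong (FSub σ ∘_) Fp∘F▷⁻¹)
        ⟨≅⟩ ∘-cong≅ (▷-cong FTy[]) refl refl (p-cong≅ FTy[]) ⟨≅⟩ ≡-to-≅ (! ▷β₁))
      (≈→≋ ([∘]t≈ ⊙ []t-cong (▷β₂≈ ⊙ cast≈ _ ⊙ FTm-cong (C.cast≈ _)) refl ⊙ Fq[F▷⁻¹])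
        ⊙ q-cong≋ FTy[] ⊙ ≈→≋ (! q[↑])))

  F▷⁻¹-cong≅ : ∀ {Γ} {T T' : C.Ty Γ} → T ≡ T' → F▷⁻¹ {Γ} {T} ≅ F▷⁻¹ {Γ} {T'}
  F▷⁻¹-cong≅ refl = refl

  FT∘ : ∀ {Γ Δ Θ} {T : C.Ty Δ} {τ : C.Sub Γ Δ} {δ : Sub Θ (FCon Γ)} →
        FTy (T C.[ τ ]T) [ δ ]T ≡ FTy T [ FSub τ ∘ δ ]T
  FT∘ = cong (_[ _ ]T) FTy[] ⊙ ! [∘]T

  module FΣ-Iso {Γ : C.Con} (A : C.Ty Γ) (B : C.Ty (Γ C.▷ A)) where
    S : C.Ty Γ
    S = C.Σ' A B
    FA : Ty (FCon Γ)
    FA = FTy A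
    B̂ : Ty (FCon Γ ▷ FA)
    B̂ = FTy B [ F▷⁻¹ ]T
    fst : C.Tm (Γ C.▷ S) (A C.[ C.p ]T)
    fst = C.π₁ C.p C.q
    snd : C.Tm (Γ C.▷ S) (B C.[ C.p C.↑ A ]T C.[ C.⟨ fst ⟩ ]T)
    snd = C.π₂ C.p C.q
    snd′ : C.Tm (Γ C.▷ S) (B C.[ C.p C.,s fst ]T)
    snd′ = C.cast (! C.[∘]T ⊙ cong (B C.[_]T) C.↑⟨⟩) snd
    F▷⁻¹S : Sub (FCon Γ ▷ FTy S) (FCon (Γ C.▷ S))
    F▷⁻¹S = F▷⁻¹
    fst-ty : FTy (A C.[ C.p ]T) [ F▷⁻¹S ]T ≡ FA [ p ]T
    fst-ty = FT∘ ⊙ cong (FA [_]T) Fp∘F▷⁻¹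
    Ffst : Tm (FCon Γ ▷ FTy S) (FA [ p ]T)
    Ffst = cast fst-ty (FTm fst [ F▷⁻¹S ]t)
    F[p,fst] : FSub (C.p C.,s fst) ∘ F▷⁻¹S ≡ F▷⁻¹ ∘ (p ,s Ffst)
    F[p,fst] = cong (_∘ F▷⁻¹S) F,s ⊙ ass ⊙ cong (F▷⁻¹ ∘_) (,∘ ⊙ ,s-cong Fp∘F▷⁻¹ (cast≈ _
        ⊙ []t-cong (cast≈ _) refl ⊙ ! cast≈ _))
    snd-ty : FTy (B C.[ C.p C.,s fst ]T) [ F▷⁻¹S ]T ≡ B̂ [ p ↑ FA ]T [ ⟨ Ffst ⟩ ]T
    snd-ty = FT∘ ⊙ cong (FTy B [_]T) (F[p,fst] ⊙ cong (F▷⁻¹ ∘_) (! ↑⟨⟩) ⊙ ! ass) ⊙ [∘]T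
        ⊙ cong (_[ ⟨ Ffst ⟩ ]T) [∘]T
    Fsnd : Tm (FCon Γ ▷ FTy S) (B̂ [ p ↑ FA ]T [ ⟨ Ffst ⟩ ]T)
    Fsnd = cast snd-ty (FTm snd′ [ F▷⁻¹S ]t)
    to : TyHom (FCon Γ) (FTy S) (Σ' FA B̂)
    to = pairπ p Ffst Fsnd

    Y : Con
    Y = FCon Γ ▷ Σ' FA B̂
    fstD : Tm Y (FA [ p ]T)
    fstD = π₁ p q
    sndD : Tm Y (B̂ [ p ↑ FA ]T [ ⟨ fstD ⟩ ]T)
    sndD = π₂ p q
    ρA : Sub Y (FCon (Γ C.▷ A))
    ρA = F▷⁻¹ ∘ (p ,s fstD)
    sndD-ty : B̂ [ p ↑ FA ]T [ ⟨ fstD ⟩ ]T ≡ FTy B [ ρA ]T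
    sndD-ty = ! cong (_[ ⟨ fstD ⟩ ]T) [∘]T ⊙ ! [∘]T ⊙ cong (FTy B [_]T) (ass ⊙ cong (F▷⁻¹ ∘_) ↑⟨⟩)
    sndD′ : Tm Y (FTy B [ ρA ]T)
    sndD′ = cast sndD-ty sndD
    ρAB : Sub Y (FCon (Γ C.▷ A C.▷ B))
    ρAB = F▷⁻¹ ∘ (ρA ,s sndD′)
    varA : C.Tm (Γ C.▷ A C.▷ B) (A C.[ C.p C.∘ C.p ]T)
    varA = C.cast (! C.[∘]T) (C.q C.[ C.p ]t)
    varB-ty : B C.[ C.p ]T ≡ B C.[ (C.p C.∘ C.p) C.↑ A ]T C.[ C.⟨ varA ⟩ ]T
    varB-ty = cong (B C.[_]T) (C.,s-unique refl (! C.cast≈ _) ⊙ ! C.↑⟨⟩) ⊙ C.[∘]T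
    varB : C.Tm (Γ C.▷ A C.▷ B) (B C.[ (C.p C.∘ C.p) C.↑ A ]T C.[ C.⟨ varA ⟩ ]T)
    varB = C.cast varB-ty C.q
    pairVar : C.Tm (Γ C.▷ A C.▷ B) (S C.[ C.p C.∘ C.p ]T)
    pairVar = C.pairπ (C.p C.∘ C.p) varA varB
    pairSub : C.Sub (Γ C.▷ A C.▷ B) (Γ C.▷ S)
    pairSub = (C.p C.∘ C.p) C.,s pairVar
    Fpp∘ρAB : FSub (C.p C.∘ C.p) ∘ ρAB ≡ p
    Fpp∘ρAB = cong (_∘ ρAB) F-∘ ⊙ ass ⊙ cong (FSub C.p ∘_) (! ass ⊙ cong (_∘ (ρA ,s sndD′)) Fp∘F▷⁻¹
        ⊙ ▷β₁) ⊙ ! ass ⊙ cong (_∘ (p ,s fstD)) Fp∘F▷⁻¹ ⊙ ▷β₁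
    pairVar-ty : FTy (S C.[ C.p C.∘ C.p ]T) [ ρAB ]T ≡ FTy S [ p ]T
    pairVar-ty = FT∘ ⊙ cong (FTy S [_]T) Fpp∘ρAB
    from : TyHom (FCon Γ) (Σ' FA B̂) (FTy S)
    from = cast pairVar-ty (FTm pairVar [ ρAB ]t)

    p,from : Sub Y (FCon Γ ▷ FTy S)
    p,from = p ,s from
    F▷⁻¹S∘p,from : F▷⁻¹S ∘ p,from ≡ FSub pairSub ∘ ρAB
    F▷⁻¹S∘p,from = cong (F▷⁻¹ ∘_) (! (cong (_∘ ρAB) F▷∘F,s ⊙ ,∘ ⊙ ,s-cong Fpp∘ρAB (cast≈ _
        ⊙ []t-cong (cast≈ _) refl ⊙ ! cast≈ pairVar-ty))) ⊙ ! ass ⊙ cong (_∘ ρAB) (! ass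
        ⊙ cong (_∘ FSub pairSub) F▷-inv₁ ⊙ idl)
    fst[pairSub] : fst C.[ pairSub ]t C.≈ C.q C.[ C.p ]t
    fst[pairSub] = C.π₁-[]′ C.▷β₁ C.▷β₂≈ ⊙ C.≡→≈ C.π₁-β ⊙ C.cast≈ _
    snd′[pairSub] : snd′ C.[ pairSub ]t C.≈ C.q {A = B}
    snd′[pairSub] = C.[]t-cong (C.cast≈ _) refl ⊙ C.π₂-[]′ C.▷β₁ C.▷β₂≈ ⊙ C.π₂-β ⊙ C.cast≈ _
    Fp∘ρAB : FSub C.p ∘ ρAB ≡ ρA
    Fp∘ρAB = ! ass ⊙ cong (_∘ (ρA ,s sndD′)) Fp∘F▷⁻¹ ⊙ ▷β₁
    Ffst[p,from] : Ffst [ p,from ]t ≈ fstD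
    Ffst[p,from] = []t-cong (cast≈ _) refl ⊙ ! [∘]t≈ ⊙ []t-cong refl F▷⁻¹S∘p,from ⊙ [∘]t≈
        ⊙ []t-cong (! FTm[]≈ ⊙ FTm-cong fst[pairSub] ⊙ FTm[]≈) refl ⊙ ! [∘]t≈ ⊙ []t-cong refl Fp∘ρAB
        ⊙ [∘]t≈ ⊙ []t-cong Fq[F▷⁻¹] refl ⊙ ▷β₂≈
    Fsnd[p,from] : Fsnd [ p,from ]t ≈ sndD
    Fsnd[p,from] = []t-cong (cast≈ _) refl ⊙ ! [∘]t≈ ⊙ []t-cong refl F▷⁻¹S∘p,from ⊙ [∘]t≈
        ⊙ []t-cong (! FTm[]≈ ⊙ FTm-cong snd′[pairSub]) refl ⊙ [∘]t≈ ⊙ []t-cong Fq[F▷⁻¹] refl ⊙ ▷β₂≈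
        ⊙ cast≈ _
    to-from : tyComp to from ≡ tyId
    to-from = tyComp≡tyId (pairπ-[]′ ▷β₁ Ffst[p,from] Fsnd[p,from] ⊙ ≡→≈ pairπ-η)

    p,to : Sub (FCon Γ ▷ FTy S) Y
    p,to = p ,s to
    fstD[p,to] : fstD [ p,to ]t ≈ Ffst
    fstD[p,to] = π₁-[]′ ▷β₁ ▷β₂≈ ⊙ ≡→≈ π₁-β
    sndD[p,to] : sndD [ p,to ]t ≈ Fsnd
    sndD[p,to] = π₂-[]′ ▷β₁ ▷β₂≈ ⊙ π₂-β
    unpairSub : C.Sub (Γ C.▷ S) (Γ C.▷ A C.▷ B)
    unpairSub = (C.p C.,s fst) C.,s snd′
    ρA∘p,to : ρA ∘ p,to ≡ FSub (C.p C.,s fst) ∘ F▷⁻¹S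
    ρA∘p,to = ass ⊙ cong (F▷⁻¹ ∘_) (,∘ ⊙ ,s-cong ▷β₁ (cast≈ _ ⊙ fstD[p,to])) ⊙ ! F[p,fst]
    ρAB∘p,to : ρAB ∘ p,to ≡ FSub unpairSub ∘ F▷⁻¹S
    ρAB∘p,to = ass ⊙ cong (F▷⁻¹ ∘_) (,∘ ⊙ ,s-cong ρA∘p,to (cast≈ _ ⊙ []t-cong (cast≈ _) refl
        ⊙ sndD[p,to] ⊙ cast≈ _ ⊙ ! []t-cong (cast≈ _) refl ⊙ ! cast≈ _) ⊙ ! ,∘) ⊙ ! ass
        ⊙ cong (_∘ F▷⁻¹S) (! F,s)
    pairVar[unpairSub] : pairVar C.[ unpairSub ]t C.≈ C.q {A = S}
    pairVar[unpairSub] = C.pairπ-[]′ (C.ass ⊙ cong (C.p C.∘_) C.▷β₁ ⊙ C.▷β₁)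
            (C.[]t-cong (C.cast≈ _) refl ⊙ ! C.[∘]t≈ ⊙ C.[]t-cong refl C.▷β₁ ⊙ C.▷β₂≈)
            (C.[]t-cong (C.cast≈ _) refl ⊙ C.▷β₂≈ ⊙ C.cast≈ _)
          ⊙ C.≡→≈ C.pairπ-η
    from-to : tyComp from to ≡ tyId
    from-to = tyComp≡tyId ([]t-cong (cast≈ _) refl ⊙ ! [∘]t≈ ⊙ []t-cong refl ρAB∘p,to ⊙ [∘]t≈
                         ⊙ []t-cong (! FTm[]≈ ⊙ FTm-cong pairVar[unpairSub]) refl ⊙ Fq[F▷⁻¹])

    iso : TyIso (FCon Γ) (FTy S) (Σ' FA B̂)
    iso = record { to = to ; from = from ; from-to = from-to ; to-from = to-from }

    module _ (t : C.Tm Γ S) where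
      private
        x : Tm (FCon Γ) (FTy S)
        x = FTm t
        s' : Tm (FCon Γ) (Σ' FA B̂ [ id ]T)
        s' = cast (! [id]T) (apHom to x)
        ts' : to [ ⟨ x ⟩ ]t ≈ s'
        ts' = ! apHom≈ ⊙ ! cast≈ (! [id]T)
      F-proj₁ : FTm (C.proj₁ t) ≡ proj₁ (apHom to x)
      F-proj₁ = ≈→≡ (FTm-cong (C.proj₁-π (! C.cast≈ (! C.[id]T)) ⊙ ! C.π₁-[]′ C.▷β₁ (C.q[⟨⟩]
          ⊙ ! C.cast≈ (! C.[id]T))) ⊙ FTm[]≈ ⊙ []t-cong refl F⟨⟩ ⊙ [∘]t≈ ⊙ []t-cong (! cast≈ _
          ⊙ ! ≡→≈ π₁-β) refl ⊙ π₁-[]′ ▷β₁ ts' ⊙ ! proj₁-π (! cast≈ (! [id]T)))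
      F-proj₂ : FTm (C.proj₂ t) ≅ proj₂ (apHom to x)
      F-proj₂ = ≋→≅ (≈→≋ (FTm-cong (C.proj₂-π (! C.cast≈ (! C.[id]T)) ⊙ ! C.π₂-[]′ C.▷β₁ (C.q[⟨⟩]
          ⊙ ! C.cast≈ (! C.[id]T)) ⊙ C.[]t-cong (! C.cast≈ _) refl) ⊙ FTm[]≈ ⊙ []t-cong refl F⟨⟩
          ⊙ [∘]t≈ ⊙ []t-cong (! cast≈ _ ⊙ ! π₂-β) refl ⊙ π₂-[]′ ▷β₁ ts'
          ⊙ ! proj₂-π (! cast≈ (! [id]T))))

    module _ (a : C.Tm Γ A) (b : C.Tm Γ (B C.[ C.⟨ a ⟩ ]T))
             (b' : Tm (FCon Γ) (B̂ [ ⟨ FTm a ⟩ ]T)) (eb : b' ≅ FTm b) where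
      private
        pairD : Tm (FCon Γ) (Σ' FA B̂)
        pairD = pairΣ {B = B̂} (FTm a) b'
        δ : C.Sub Γ (Γ C.▷ A C.▷ B)
        δ = C.⟨ a ⟩ C.,s b
        pp∘δ : (C.p C.∘ C.p) C.∘ δ ≡ C.id
        pp∘δ = C.ass ⊙ cong (C.p C.∘_) C.▷β₁ ⊙ C.▷β₁
        z : C.Tm Γ (S C.[ C.p C.∘ C.p ]T C.[ δ ]T)
        z = pairVar C.[ δ ]t
        eX : S C.[ C.p C.∘ C.p ]T C.[ δ ]T ≡ S
        eX = ! C.[∘]T ⊙ cong (S C.[_]T) pp∘δ ⊙ C.[id]T
        X : C.Tm Γ S
        X = C.cast eX z
        X' : C.Tm Γ (S C.[ C.id ]T)
        X' = C.cast (! C.[id]T) X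
        zX' : z C.≈ X'
        zX' = ! C.cast≈ eX ⊙ ! C.cast≈ (! C.[id]T)
        varA[δ] : varA C.[ δ ]t C.≈ a
        varA[δ] = C.[]t-cong (C.cast≈ _) refl ⊙ ! C.[∘]t≈ ⊙ C.[]t-cong refl C.▷β₁ ⊙ C.q[⟨⟩]
        varB[δ] : varB C.[ δ ]t C.≈ b
        varB[δ] = C.[]t-cong (C.cast≈ _) refl ⊙ C.▷β₂≈
        pairVar[δ] : z C.≈ C.pairΣ a b
        pairVar[δ] = ! C.cast≈ eX ⊙ C.≡→≈ (! C.Ση
            ⊙ C.pair≈ (C.≈→≡ (C.proj₁-π (! C.cast≈ (! C.[id]T)) ⊙ ! C.π₁-[]′ pp∘δ zX'
            ⊙ C.[]t-cong (C.≡→≈ C.π₁-β) refl ⊙ varA[δ])) (C.proj₂-π (! C.cast≈ (! C.[id]T))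
            ⊙ ! C.π₂-[]′ pp∘δ zX' ⊙ C.[]t-cong C.π₂-β refl ⊙ varB[δ]))
        fstD[pairD] : fstD [ ⟨ pairD ⟩ ]t ≈ FTm a
        fstD[pairD] = π₁-[]′ ▷β₁ (q[⟨⟩] ⊙ ! cast≈ (! [id]T)) ⊙ ! proj₁-π (! cast≈ (! [id]T))
            ⊙ ≡→≈ Σβ₁
        eb' : B̂ [ ⟨ FTm a ⟩ ]T ≡ FTy (B C.[ C.⟨ a ⟩ ]T)
        eb' = ! [∘]T ⊙ cong (FTy B [_]T) (! F⟨⟩) ⊙ ! FTy[]
        sndD[pairD] : sndD [ ⟨ pairD ⟩ ]t ≈ FTm b
        sndD[pairD] = π₂-[]′ ▷β₁ (q[⟨⟩] ⊙ ! cast≈ (! [id]T)) ⊙ ! proj₂-π (! cast≈ (! [id]T)) ⊙ Σβ₂≈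
            ⊙ ≅→≈ eb' eb
        ρA∘⟨pairD⟩ : ρA ∘ ⟨ pairD ⟩ ≡ FSub C.⟨ a ⟩
        ρA∘⟨pairD⟩ = ass ⊙ cong (F▷⁻¹ ∘_) (,∘ ⊙ ,s-cong ▷β₁ (cast≈ _ ⊙ fstD[pairD] ⊙ ! cast≈ _))
            ⊙ ! F⟨⟩
        ρAB∘⟨pairD⟩ : ρAB ∘ ⟨ pairD ⟩ ≡ FSub δ
        ρAB∘⟨pairD⟩ = ass ⊙ cong (F▷⁻¹ ∘_) (,∘ ⊙ ,s-cong ρA∘⟨pairD⟩ (cast≈ _
            ⊙ []t-cong (cast≈ _) refl ⊙ sndD[pairD] ⊙ ! cast≈ _)) ⊙ ! F,s
      F-pair : FTm (C.pairΣ a b) ≡ apHom from pairD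
      F-pair = ≈→≡ (! FTm-cong pairVar[δ] ⊙ FTm[]≈ ⊙ []t-cong refl (! ρAB∘⟨pairD⟩) ⊙ [∘]t≈
          ⊙ []t-cong (! cast≈ _) refl ⊙ ! apHom≈)

  module FΣ-Nat {Γ Δ : C.Con} (σ : C.Sub Γ Δ) (A : C.Ty Δ) (B : C.Ty (Δ C.▷ A)) where
    module S₁ = FΣ-Iso A B
    module S₂ = FΣ-Iso (A C.[ σ ]T) (B C.[ σ C.↑ A ]T)
    S : C.Ty Δ
    S = C.Σ' A B
    S' : C.Ty Γ
    S' = C.Σ' (A C.[ σ ]T) (B C.[ σ C.↑ A ]T)
    eS : FTy S [ FSub σ ]T ≡ FTy S'
    eS = ! FTy[] ⊙ cong FTy C.Σ[]
    to[σ] : TyHom (FCon Γ) (FTy S [ FSub σ ]T) (Σ' (FTy A) S₁.B̂ [ FSub σ ]T)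
    to[σ] = reindex (FSub σ) S₁.to
    tL : Tm (FCon Γ ▷ FTy S [ FSub σ ]T) (Σ' (FTy A [ FSub σ ]T) (S₁.B̂ [ FSub σ ↑ FTy A ]T) [ p ]T)
    tL = cast (cong (_[ p ]T) Σ[]) to[σ]
    t₁ : Tm (FCon Γ ▷ FTy S [ FSub σ ]T) (Σ' (FTy A) S₁.B̂ [ FSub σ ∘ p ]T)
    t₁ = cast (! [∘]T) to[σ]
    t₁L : t₁ ≈ tL
    t₁L = cast≈ (! [∘]T) ⊙ ! cast≈ (cong (_[ p ]T) Σ[])
    t₁T : t₁ ≈ S₁.to [ FSub σ ↑ FTy S ]t
    t₁T = cast≈ (! [∘]T) ⊙ reindex≈
    eA : FTy A [ FSub σ ]T ≡ FTy (A C.[ σ ]T)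
    eA = ! FTy[]
    eB : S₁.B̂ [ FSub σ ↑ FTy A ]T ≅ S₂.B̂
    eB = ≡-to-≅ (! [∘]T) ⟨≅⟩ []T-cong≅ (▷-cong eA) refl refl (H.sym F↑)
        ⟨≅⟩ ≡-to-≅ ([∘]T ⊙ cong (_[ F▷⁻¹ ]T) (! FTy[]))
    qσ : C.q C.[ σ C.↑ S ]t C.≈ C.cast (! C.[∘]T) (C.q {A = S C.[ σ ]T})
    qσ = C.q[↑] ⊙ ! C.cast≈ _
    qS' : C.cast (cong (C._[ C.p ]T) C.Σ[]) (C.q {A = S C.[ σ ]T}) C.≋ C.q {A = S'}
    qS' = C.≈→≋ (C.cast≈ _) ⊙ C.q-cong≋ C.Σ[]
    fst[σ↑] : S₁.fst C.[ σ C.↑ S ]t C.≋ S₂.fst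
    fst[σ↑] = C.≈→≋ (C.π₁-[] (! C.cast≈ (! C.[∘]T)) ⊙ C.π₁-cong C.p∘↑ (C.cast≈ (! C.[∘]T) ⊙ qσ)
        ⊙ C.π₁-reassoc (C.cast≈ (! C.[∘]T) ⊙ ! C.cast≈ (cong (C._[ C.p ]T) C.Σ[])))
        ⊙ C.π₁-cong≋ (C.▷-cong C.Σ[]) (C.p-cong≅ C.Σ[]) qS'
    snd′[σ↑] : S₁.snd′ C.[ σ C.↑ S ]t C.≋ S₂.snd′
    snd′[σ↑] = C.≈→≋ (C.[]t-cong (C.cast≈ _) refl ⊙ C.π₂-[] (! C.cast≈ (! C.[∘]T))
        ⊙ C.π₂-cong C.p∘↑ (C.cast≈ (! C.[∘]T) ⊙ qσ) ⊙ C.π₂-reassoc (C.cast≈ (! C.[∘]T)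
        ⊙ ! C.cast≈ (cong (C._[ C.p ]T) C.Σ[]))) ⊙ C.π₂-cong≋ (C.▷-cong C.Σ[]) (C.p-cong≅ C.Σ[]) qS'
        ⊙ C.≈→≋ (! C.cast≈ _)
    π₁-to[σ] : π₁ p tL ≋ S₂.Ffst
    π₁-to[σ] = ≈→≋ (! π₁-reassoc t₁L ⊙ π₁-cong (! p∘↑) (t₁T ⊙ ! cast≈ (! [∘]T))
        ⊙ ! π₁-[] (! cast≈ (! [∘]T)) ⊙ []t-cong (≡→≈ π₁-β ⊙ cast≈ _) refl ⊙ ! [∘]t≈)
        ⊙ []t-cong≋ refl (▷-cong (! FTy[])) (H.sym F↑) ⊙ ≈→≋ ([∘]t≈ ⊙ []t-cong (! FTm[]≈) refl)
        ⊙ []t-cong≋ (FTm-cong≋ fst[σ↑]) (▷-cong (cong FTy C.Σ[])) (F▷⁻¹-cong≅ C.Σ[])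
        ⊙ ≈→≋ (! cast≈ _)
    π₂-to[σ] : π₂ p tL ≋ S₂.Fsnd
    π₂-to[σ] = ≈→≋ (! π₂-reassoc t₁L ⊙ π₂-cong (! p∘↑) (t₁T ⊙ ! cast≈ (! [∘]T))
        ⊙ ! π₂-[] (! cast≈ (! [∘]T)) ⊙ []t-cong (π₂-β ⊙ cast≈ _) refl ⊙ ! [∘]t≈)
        ⊙ []t-cong≋ refl (▷-cong (! FTy[])) (H.sym F↑) ⊙ ≈→≋ ([∘]t≈ ⊙ []t-cong (! FTm[]≈) refl)
        ⊙ []t-cong≋ (FTm-cong≋ snd′[σ↑]) (▷-cong (cong FTy C.Σ[])) (F▷⁻¹-cong≅ C.Σ[])
        ⊙ ≈→≋ (! cast≈ _)
    nat : reindex (FSub σ) S₁.to ≅ S₂.to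
    nat = ≋→≅ (≈→≋ (! cast≈ (cong (_[ p ]T) Σ[]))
        ⊙ pairπ-unique≋ (▷-cong eS) eA eB (p-cong≅ eS)
            (π₁-to[σ] ⊙ ≈→≋ (! ≡→≈ π₁-β)) (π₂-to[σ] ⊙ ≈→≋ (! π₂-β)))

  F∙-contr : ∀ {Z} (τ τ' : Sub Z (FCon C.∙)) → τ ≡ τ'
  F∙-contr τ τ' = τ≡F∙⁻¹∘ε τ ⊙ ! τ≡F∙⁻¹∘ε τ'
    where τ≡F∙⁻¹∘ε : ∀ {Z} (τ : Sub Z (FCon C.∙)) → τ ≡ F∙⁻¹ ∘ ε
          τ≡F∙⁻¹∘ε τ = ! idl ⊙ cong (_∘ τ) (! F∙-ret) ⊙ ass ⊙ cong (F∙⁻¹ ∘_) (∙η _)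

  module FK-Iso {Γ : C.Con} (Δ : C.Con) where
    KΓ : C.Ty Γ
    KΓ = C.K {Γ} Δ
    K₀ : C.Ty C.∙
    K₀ = C.K {C.∙} Δ
    gen : C.Sub (Γ C.▷ KΓ) Δ
    gen = C.appK (C.cast C.K[] C.q)
    to : TyHom (FCon Γ) (FTy KΓ) (K (FCon Δ))
    to = cast (! K[]) (lamK (FSub gen ∘ F▷⁻¹))
    Y : Con
    Y = FCon Γ ▷ K (FCon Δ)
    genD : Sub Y (FCon Δ)
    genD = appK (cast K[] q)
    -- Both sides reindex F (K Δ) over ∙, and substitutions into F ∙ are unique.
    from-ty : FTy (C.K {Δ} Δ) [ genD ]T ≡ FTy KΓ [ p ]T
    from-ty = cong (λ T → FTy T [ genD ]T) (! C.K[] {σ = C.ε}) ⊙ FT∘ {T = K₀} {τ = C.ε}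
         ⊙ cong (FTy K₀ [_]T) (F∙-contr _ _)
         ⊙ ! FT∘ {T = K₀} {τ = C.ε} ⊙ cong (λ T → FTy T [ p ]T) C.K[]
    from : TyHom (FCon Γ) (K (FCon Δ)) (FTy KΓ)
    from = cast from-ty (FTm (C.lamK C.id) [ genD ]t)

    p,from : Sub Y (FCon Γ ▷ FTy KΓ)
    p,from = p ,s from
    -- gen factors through ∙ ▷ K Δ; this is where uniqueness of substitutions
    -- into F ∙ enters the proof that to ∘ from is the identity.
    lamId : C.Tm Δ (K₀ C.[ C.ε ]T)
    lamId = C.cast (! C.K[]) (C.lamK C.id)
    lamId∙ : C.Sub Δ (C.∙ C.▷ K₀)
    lamId∙ = C.ε C.,s lamId
    gen∙ : C.Sub (C.∙ C.▷ K₀) Δ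
    gen∙ = C.appK (C.cast C.K[] C.q)
    q∙ : C.Tm (Γ C.▷ KΓ) (K₀ C.[ C.ε ]T)
    q∙ = C.cast (! C.K[]) (C.cast C.K[] C.q)
    proj∙ : C.Sub (Γ C.▷ KΓ) (C.∙ C.▷ K₀)
    proj∙ = C.ε C.,s q∙
    gen∙∘proj∙ : gen∙ C.∘ proj∙ ≡ gen
    gen∙∘proj∙ = C.appK∘ ⊙ cong C.appK (C.≈→≡ (C.cast≈ C.K[] ⊙ C.[]t-cong (C.cast≈ C.K[]) refl
        ⊙ C.▷β₂≈ ⊙ C.cast≈ (! C.K[])))
    gen∙∘lamId∙ : gen∙ C.∘ lamId∙ ≡ C.id
    gen∙∘lamId∙ = C.appK∘ ⊙ cong C.appK (C.≈→≡ (C.cast≈ _ ⊙ C.[]t-cong (C.cast≈ _) refl ⊙ C.▷β₂≈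
        ⊙ C.cast≈ _)) ⊙ C.Kβ
    Fproj∙∘F▷⁻¹-from : FSub proj∙ ∘ (F▷⁻¹ ∘ p,from) ≡ FSub lamId∙ ∘ genD
    Fproj∙∘F▷⁻¹-from = cong (_∘ (F▷⁻¹ ∘ p,from)) F,s ⊙ ass ⊙ cong (F▷⁻¹ ∘_) (,∘
        ⊙ ,s-cong (F∙-contr _ _) (cast≈ _ ⊙ []t-cong (cast≈ _) refl ⊙ [∘]t≈
        ⊙ []t-cong ([]t-cong (FTm-cong (C.cast≈ (! C.K[]) ⊙ C.cast≈ C.K[])) refl ⊙ Fq[F▷⁻¹]) refl
        ⊙ ▷β₂≈ ⊙ cast≈ from-ty ⊙ []t-cong (! FTm-cong (C.cast≈ (! C.K[])) ⊙ ! cast≈ FTy[]) refl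
        ⊙ ! cast≈ (! [∘]T)) ⊙ ! ,∘) ⊙ ! ass ⊙ cong (_∘ genD) (! F,s)
    Fgen∘F▷⁻¹-from : FSub gen ∘ (F▷⁻¹ ∘ p,from) ≡ genD
    Fgen∘F▷⁻¹-from = cong (λ z → FSub z ∘ (F▷⁻¹ ∘ p,from)) (! gen∙∘proj∙)
        ⊙ cong (_∘ (F▷⁻¹ ∘ p,from)) F-∘ ⊙ ass ⊙ cong (FSub gen∙ ∘_) Fproj∙∘F▷⁻¹-from ⊙ ! ass
        ⊙ cong (_∘ genD) (! F-∘ ⊙ cong FSub gen∙∘lamId∙ ⊙ F-id) ⊙ idl
    to-from : tyComp to from ≡ tyId
    to-from = tyComp≡tyId ([]t-cong (cast≈ _) refl ⊙ ! cast≈ K[] ⊙ ≡→≈ (! lamK[] ⊙ cong lamK (ass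
        ⊙ Fgen∘F▷⁻¹-from) ⊙ Kη) ⊙ cast≈ _)

    p,to : Sub (FCon Γ ▷ FTy KΓ) Y
    p,to = p ,s to
    genD∘p,to : genD ∘ p,to ≡ FSub gen ∘ F▷⁻¹
    genD∘p,to = appK∘ ⊙ cong appK (≈→≡ (cast≈ _ ⊙ []t-cong (cast≈ _) refl ⊙ ▷β₂≈ ⊙ cast≈ (! K[])))
        ⊙ Kβ
    lamId[gen] : C.lamK C.id C.[ gen ]t C.≈ C.q {A = KΓ}
    lamId[gen] = ! C.cast≈ C.K[] ⊙ C.≡→≈ (! C.lamK[] ⊙ cong C.lamK C.idl ⊙ C.Kη) ⊙ C.cast≈ _
    from-to : tyComp from to ≡ tyId
    from-to = tyComp≡tyId ([]t-cong (cast≈ _) refl ⊙ ! [∘]t≈ ⊙ []t-cong refl genD∘p,to ⊙ [∘]t≈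
                          ⊙ []t-cong (! FTm[]≈ ⊙ FTm-cong lamId[gen]) refl ⊙ Fq[F▷⁻¹])

    iso : TyIso (FCon Γ) (FTy KΓ) (K (FCon Δ))
    iso = record { to = to ; from = from ; from-to = from-to ; to-from = to-from }

    F-lamK : ∀ (σ : C.Sub Γ Δ) → FTm (C.lamK σ) ≡ apHom from (lamK (FSub σ))
    F-lamK σ = ≈→≡ (! FTm-cong lamId[σ] ⊙ FTm[]≈ ⊙ []t-cong refl (! genD∘⟨lamK⟩) ⊙ [∘]t≈
        ⊙ []t-cong (! cast≈ _) refl ⊙ ! apHom≈)
      where
        genD∘⟨lamK⟩ : genD ∘ ⟨ lamK (FSub σ) ⟩ ≡ FSub σ
        genD∘⟨lamK⟩ = appK∘ ⊙ cong appK (≈→≡ (cast≈ _ ⊙ []t-cong (cast≈ _) refl ⊙ q[⟨⟩])) ⊙ Kβ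
        lamId[σ] : C.lamK C.id C.[ σ ]t C.≈ C.lamK σ
        lamId[σ] = ! C.cast≈ C.K[] ⊙ C.≡→≈ (! C.lamK[] ⊙ cong C.lamK C.idl)

    F-appK : ∀ (t : C.Tm Γ (C.K Δ)) → FSub (C.appK t) ≡ appK (apHom to (FTm t))
    F-appK t = ! cong FSub gen∘⟨t⟩ ⊙ F-∘ ⊙ cong (FSub gen ∘_) F⟨⟩ ⊙ ! ass
        ⊙ cong (_∘ ⟨ FTm t ⟩) (! Kβ) ⊙ appK∘ ⊙ cong appK (≈→≡ (cast≈ _ ⊙ []t-cong (! cast≈ _) refl
        ⊙ ! apHom≈))
      where
        gen∘⟨t⟩ : gen C.∘ C.⟨ t ⟩ ≡ C.appK t
        gen∘⟨t⟩ = C.appK∘ ⊙ cong C.appK (C.≈→≡ (C.cast≈ _ ⊙ C.[]t-cong (C.cast≈ _) refl ⊙ C.q[⟨⟩]))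

  module FK-Nat {Γ Θ : C.Con} (σ : C.Sub Γ Θ) (Δ : C.Con) where
    module K₁ = FK-Iso {Θ} Δ
    module K₂ = FK-Iso {Γ} Δ
    gen[σ↑] : K₁.gen C.∘ (σ C.↑ C.K {Θ} Δ) ≅ K₂.gen
    gen[σ↑] = ≡-to-≅ C.appK∘ ⟨≅⟩ C.appK-cong≅ (C.▷-cong C.K[]) (C.≈→≋ (C.cast≈ C.K[]
        ⊙ C.[]t-cong (C.cast≈ C.K[]) refl ⊙ C.q[↑]) ⊙ C.q-cong≋ C.K[] ⊙ C.≈→≋ (! C.cast≈ C.K[]))
    FK[σ] : FTy (C.K {Θ} Δ) [ FSub σ ]T ≡ FTy (C.K {Γ} Δ)
    FK[σ] = ! FTy[] ⊙ cong FTy C.K[]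
    Fgen[σ↑] : (FSub K₁.gen ∘ F▷⁻¹) ∘ (FSub σ ↑ FTy (C.K {Θ} Δ)) ≅ FSub K₂.gen ∘ F▷⁻¹
    Fgen[σ↑] = ≡-to-≅ ass ⟨≅⟩ ∘-cong≅ (▷-cong (! FTy[])) refl refl (H.sym F↑)
        ⟨≅⟩ ≡-to-≅ (! ass ⊙ cong (_∘ F▷⁻¹) (! F-∘))
        ⟨≅⟩ ∘-cong≅ (cong (FCon Γ ▷_) (cong FTy C.K[])) (cong FCon (C.▷-cong C.K[]))
              (FSub-cong≅ (C.▷-cong C.K[]) gen[σ↑]) (F▷⁻¹-cong≅ C.K[])
    nat : reindex (FSub σ) K₁.to ≅ K₂.to
    nat = ≋→≅ (≈→≋ (reindex≈ ⊙ []t-cong (cast≈ (! K[])) refl ⊙ ! cast≈ K[] ⊙ ≡→≈ (! lamK[]))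
                 ⊙ lamK-cong≋ (▷-cong FK[σ]) Fgen[σ↑] ⊙ ≈→≋ (! cast≈ (! K[])))

  module FId-Iso {Γ : C.Con} (A : C.Ty Γ) (t u : C.Tm Γ A) where
    I : C.Ty Γ
    I = C.Id A t u
    t≡u : t C.[ C.p {A = I} ]t ≡ u C.[ C.p ]t
    t≡u = C.reflect (C.cast C.Id[] C.q)
    Ft≡Fu : FTm t [ p {A = FTy I} ]t ≡ FTm u [ p ]t
    Ft≡Fu = ≈→≡ ([]t-cong refl (! Fp∘F▷⁻¹) ⊙ [∘]t≈ ⊙ []t-cong (! FTm[]≈ ⊙ FTm-cong (C.≡→≈ t≡u)
        ⊙ FTm[]≈) refl ⊙ ! [∘]t≈ ⊙ []t-cong refl Fp∘F▷⁻¹)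
    to : TyHom (FCon Γ) (FTy I) (Id (FTy A) (FTm t) (FTm u))
    to = cast (! Id[]) (cast (cong (Id _ _) Ft≡Fu) reflId)

    Ft≡Fu′ : FTm t [ p {A = Id (FTy A) (FTm t) (FTm u)} ]t ≡ FTm u [ p ]t
    Ft≡Fu′ = reflect (cast Id[] q)
    IdFam : C.Ty (Γ C.▷ A)
    IdFam = C.Id (A C.[ C.p ]T) (t C.[ C.p ]t) C.q
    IdFam[⟨⟩] : ∀ (x : C.Tm Γ A) → IdFam C.[ C.⟨ x ⟩ ]T ≡ C.Id A t x
    IdFam[⟨⟩] x = C.Id[] ⊙ C.Id-cong (! C.[∘]t≈ ⊙ C.[]t-cong refl C.▷β₁ ⊙ C.[id]t≈) C.q[⟨⟩]
    F⟨t⟩∘p≡F⟨u⟩∘p : FSub C.⟨ t ⟩ ∘ p {A = Id (FTy A) (FTm t) (FTm u)} ≡ FSub C.⟨ u ⟩ ∘ p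
    F⟨t⟩∘p≡F⟨u⟩∘p = cong (_∘ p) F⟨⟩ ⊙ ass ⊙ cong (F▷⁻¹ ∘_) (⟨⟩∘ ⊙ ,s-cong refl (≡→≈ Ft≡Fu′))
          ⊙ ! (cong (_∘ p) F⟨⟩ ⊙ ass ⊙ cong (F▷⁻¹ ∘_) ⟨⟩∘)
    from-ty : FTy (C.Id A t t) [ p {A = Id (FTy A) (FTm t) (FTm u)} ]T ≡ FTy I [ p ]T
    from-ty = cong (λ Z → FTy Z [ p ]T) (! IdFam[⟨⟩] t) ⊙ FT∘ ⊙ cong (FTy IdFam [_]T) F⟨t⟩∘p≡F⟨u⟩∘p
        ⊙ ! FT∘ ⊙ cong (λ Z → FTy Z [ p ]T) (IdFam[⟨⟩] u)
    from : TyHom (FCon Γ) (Id (FTy A) (FTm t) (FTm u)) (FTy I)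
    from = cast from-ty (FTm (C.reflId {t = t}) [ p ]t)

    to-from : tyComp to from ≡ tyId
    to-from = Id-UIP Id[] _ _
    q≡refl[p] : C.q {A = I} C.≈ C.reflId {t = t} C.[ C.p ]t
    q≡refl[p] = ! C.cast≈ (C.Id[] ⊙ cong (C.Id _ _) (! t≡u) ⊙ ! C.Id[])
        ⊙ C.≡→≈ (C.Id-UIP C.Id[] _ _)
    from-to : tyComp from to ≡ tyId
    from-to = tyComp≡tyId ([]t-cong (cast≈ _) refl ⊙ ! [∘]t≈ ⊙ []t-cong refl ▷β₁ ⊙ ! (! Fq[F▷⁻¹]
        ⊙ []t-cong (FTm-cong q≡refl[p] ⊙ FTm[]≈) refl ⊙ ! [∘]t≈ ⊙ []t-cong refl Fp∘F▷⁻¹))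

    iso : TyIso (FCon Γ) (FTy I) (Id (FTy A) (FTm t) (FTm u))
    iso = record { to = to ; from = from ; from-to = from-to ; to-from = to-from }

  F-refl : ∀ {Γ} {A : C.Ty Γ} {t : C.Tm Γ A} →
           FTm (C.reflId {t = t}) ≡ apHom (FId-Iso.from A t t) reflId
  F-refl {A = A} {t} = ≈→≡ (! [id]t≈ ⊙ []t-cong refl (! ▷β₁) ⊙ [∘]t≈
      ⊙ []t-cong (! cast≈ (FId-Iso.from-ty A t t)) refl ⊙ ! apHom≈)

  module FId-Nat {Γ Δ : C.Con} (σ : C.Sub Γ Δ) (A : C.Ty Δ) (t u : C.Tm Δ A) where
    module I₁ = FId-Iso A t u
    module I₂ = FId-Iso (A C.[ σ ]T) (t C.[ σ ]t) (u C.[ σ ]t)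
    eI : FTy (C.Id A t u) [ FSub σ ]T ≡ FTy (C.Id (A C.[ σ ]T) (t C.[ σ ]t) (u C.[ σ ]t))
    eI = ! FTy[] ⊙ cong FTy C.Id[]
    nat : reindex (FSub σ) I₁.to ≅ I₂.to
    nat = ≋→≅ (Id-UIP≋ (▷-cong eI) ([]T-cong≅ (▷-cong eI) refl (≡-to-≅ (Id[]
        ⊙ Id-cong (! FTm[]≈) (! FTm[]≈))) (p-cong≅ eI)) Id[] _ _)

theorem2 : ∀ {i j k l i' j' k' l' : Level}
    (C : FlCwF i j k l) (D : FlCwF i' j' k' l')
    (F : WeakMor (FlCwF.cwf C) (FlCwF.cwf D)) →
    PreservesFl C D F
theorem2 C D F = record
  { FΣ      = FΣ-Iso.iso
  ; FK      = FK-Iso.iso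
  ; FId     = FId-Iso.iso
  ; FΣ-nat  = FΣ-Nat.nat
  ; FK-nat  = FK-Nat.nat
  ; FId-nat = FId-Nat.nat
  ; F-proj₁ = λ t → FΣ-Iso.F-proj₁ _ _ t
  ; F-proj₂ = λ t → FΣ-Iso.F-proj₂ _ _ t
  ; F-pair  = FΣ-Iso.F-pair _ _
  ; F-refl  = F-refl
  ; F-lamK  = FK-Iso.F-lamK _
  ; F-appK  = FK-Iso.F-appK _
  }
  where open WeakMor-Properties C D F
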